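{- Let $G=(X,Y,E)$ be a connected chain graph whose proper ordered chain partition $X_1,\dots,X_k$, $Y_1,\dots,Y_k$ has $k=2$. Then: (1) If $G$ has no pendent vertex and $|X|=3$ or $|Y|=3$, then $\gamma_{cs}(G)=3$; if $G$ has no pendent vertex and neither $|X|=3$ nor $|Y|=3$, then $\gamma_{cs}(G)=4$. (2) If $X$ contains more than one pendent vertex, or $Y$ contains more than one pendent vertex, or both, then with $G_1=G[X_1\cup Y_1]$ and $G_2=G[X_2\cup Y_2]$ we have $\gamma_{cs}(G)=\gamma_{cs}(G_1)+\gamma_{cs}(G_2)$. (3) If $X$ contains at most one pendent vertex and $Y$ contains at most one pendent vertex, then: if $|X|=2$ or $|Y|=2$, $\gamma_{cs}(G)=2$; else if $|X|=3$ or $|Y|=3$, $\gamma_{cs}(G)=3$; otherwise $\gamma_{cs}(G)=4$.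
   Context: All graphs are finite, simple, undirected, without isolated vertices. A set $S$ of vertices is a cosecure dominating set if every vertex outside $S$ has a neighbour in $S$ and for every $u\in S$ there is a neighbour $v\notin S$ of $u$ such that $(S\setminus\{u\})\cup\{v\}$ is still dominating; $\gamma_{cs}(H)$ is the minimum size of a cosecure dominating set of $H$. A pendent vertex is a vertex of degree $1$. A bipartite graph $G=(X,Y,E)$ is a chain graph if $X$ can be ordered $x_1,\dots,x_{n_1}$ with $N(x_1)\subseteq\cdots\subseteq N(x_{n_1})$. Partition $X$ into classes of the relation $x\sim x'\iff N(x)=N(x')$, indexed $X_1,\dots,X_k$ so that $N(X_1)\subsetneq\cdots\subsetneq N(X_k)$ ($N(X_i)$ the common neighbourhood of $X_i$). Set $Y_1=N(X_1)$ and $Y_i=N(X_i)\setminus\bigcup_{j<i}N(X_j)$ for $i\ge2$; this is the proper ordered chain partition. $G[Z]$ denotes the subgraph induced by $Z$. -}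

module Defs where

open import Data.Nat using (ℕ; _≤_)
open import Data.Bool using (Bool; true; false)
open import Data.Fin using (Fin)
open import Data.Fin.Subset public
  using (Subset; _∈_; _∉_; _⊆_; _⊂_; ∁; _∩_; _∪_; _─_; _-_; ⁅_⁆; ∣_∣)
open import Data.Vec using (tabulate; lookup)
open import Data.Vec.Properties using (≡-dec)
open import Data.Bool using (_∧_; _≟_)
open import Relation.Nullary using (does)
open import Data.Product using (Σ; ∃; ∃-syntax; _×_)
open import Data.Sum using (_⊎_)
open import Relation.Nullary using (¬_)
open import Relation.Binary.PropositionalEquality using (_≡_; _≢_)

record Graph (n : ℕ) : Set where
  field
    adj   : Fin n → Fin n → Bool
    sym   : ∀ u v → adj u v ≡ adj v u
    irrefl : ∀ v → adj v v ≡ false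
open Graph public

module _ {n : ℕ} (G : Graph n) where

  Edge : Fin n → Fin n → Set
  Edge u v = adj G u v ≡ true

  N : Fin n → Subset n
  N v = tabulate (λ u → adj G v u)

  deg : Fin n → ℕ
  deg v = ∣ N v ∣

  Pendent : Fin n → Set
  Pendent v = deg v ≡ 1

  NoIsolated : Set
  NoIsolated = ∀ v → ∃[ u ] Edge v u

  data Reach : Fin n → Fin n → Set where
    here : ∀ {v} → Reach v v
    step : ∀ {u w v} → Edge u w → Reach w v → Reach u v

  Connected : Set
  Connected = ∀ u v → Reach u v

  Bipartition : Subset n → Set
  Bipartition X = ∀ u v → Edge u v → (u ∈ X → v ∉ X) × (u ∉ X → v ∈ X)

  -- chain graph with respect to the bipartition (X, ∁ X): the neighbourhoods
  -- of the vertices of X form a chain under inclusion (so X can be ordered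
  -- x₁,…,x_{n₁} with N(x₁) ⊆ ⋯ ⊆ N(x_{n₁}))
  ChainGraph : Subset n → Set
  ChainGraph X = Bipartition X ×
    (∀ x x′ → x ∈ X → x′ ∈ X → (N x ⊆ N x′) ⊎ (N x′ ⊆ N x))

  -- The proper ordered chain partition has exactly k = 2 classes, with
  -- representatives x₁ ∈ X₁ and x₂ ∈ X₂: N(X₁) = N x₁ ⊊ N x₂ = N(X₂) and every
  -- x ∈ X has neighbourhood N x₁ or N x₂.
  TwoClasses : Subset n → Fin n → Fin n → Set
  TwoClasses X x₁ x₂ = x₁ ∈ X × x₂ ∈ X × N x₁ ⊂ N x₂ ×
    (∀ x → x ∈ X → (N x ≡ N x₁) ⊎ (N x ≡ N x₂))

  MoreThanOnePendent : Subset n → Set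
  MoreThanOnePendent A = ∃[ u ] ∃[ v ] (u ≢ v × u ∈ A × v ∈ A × Pendent u × Pendent v)

  AtMostOnePendent : Subset n → Set
  AtMostOnePendent A = ∀ u v → u ∈ A → v ∈ A → Pendent u → Pendent v → u ≡ v

  -- Cosecure domination in the induced subgraph G[Z]
  -- (all vertices and neighbours are taken inside Z).
  DominatingIn : Subset n → Subset n → Set
  DominatingIn Z S = ∀ v → v ∈ Z → v ∉ S → ∃[ u ] (u ∈ S × Edge u v)

  CosecureDominatingIn : Subset n → Subset n → Set
  CosecureDominatingIn Z S =
    S ⊆ Z × DominatingIn Z S ×
    (∀ u → u ∈ S → ∃[ v ] (v ∈ Z × v ∉ S × Edge u v ×
                           DominatingIn Z ((S - u) ∪ ⁅ v ⁆)))

  GammaCSIn : Subset n → ℕ → Set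
  GammaCSIn Z k =
    (∃[ S ] (CosecureDominatingIn Z S × ∣ S ∣ ≡ k)) ×
    (∀ S → CosecureDominatingIn Z S → k ≤ ∣ S ∣)

  All : Subset n
  All = tabulate (λ _ → true)

  GammaCS : ℕ → Set
  GammaCS k = GammaCSIn All k

  XClass : Subset n → Fin n → Subset n
  XClass X x = tabulate (λ v → lookup X v ∧ does (≡-dec _≟_ (N v) (N x)))

  -- G₁ = G[X₁ ∪ Y₁] and G₂ = G[X₂ ∪ Y₂] as vertex subsets
  V₁ : Subset n → Fin n → Fin n → Subset n
  V₁ X x₁ x₂ = XClass X x₁ ∪ N x₁

  V₂ : Subset n → Fin n → Fin n → Subset n
  V₂ X x₁ x₂ = XClass X x₂ ∪ (N x₂ ─ N x₁)

module Submission where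

-- A chain graph whose proper ordered chain partition has two classes is a blow-up of the path
-- X₁ – Y₁ – X₂ – Y₂ (with Y₁ = N(X₁) and Y₂ = N(X₂) ∖ N(X₁)): two vertices are adjacent exactly when
-- their classes are.  In a blow-up, whether a set S is cosecure dominating depends only on how many
-- vertices of each class lie inside and outside S, and even only on whether these numbers are 0, 1 or
-- at least 2; the size of S is the sum of the inside numbers.  So γ_cs becomes a minimisation problem
-- on class counts.  The values claimed, min(|X|, |Y|, 4) and γ_cs(K_{|X₁|,|Y₁|}) + γ_cs(K_{|X₂|,|Y₂|}),
-- see the class sizes only up to 4, except for γ_cs(K_{1,y}) = y, which comes from the fact that a
-- class with a single vertex bounds the unselected part of its partner class by its own selected part.
-- With that, every remaining step is a finite statement about capped counts, decided by evaluation.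

import Algebra.Properties.CommutativeMonoid.Sum as Sum
open import Data.Bool.Base using (Bool; true; false; T; not; _∧_; _∨_; if_then_else_)
import Data.Bool.Properties as Bool
open import Data.Bool.Properties using (T-≡; T-∧; T-∨; ∧-zeroʳ; ∧-identityʳ; not-involutive)
open import Data.Bool.ListAction using (any)
open import Data.Empty using (⊥-elim)
open import Data.Fin.Base using (Fin; zero; suc)
open import Data.Fin.Properties using (_≟_)
open import Data.Fin.Subset using (Subset; _∈_; _∉_; _⊆_; _⊂_; ∁; _∪_; _─_; _-_; ⁅_⁆; ∣_∣)
open import Data.Fin.Subset.Properties using (x∈∁p⇒x∉p; x∉p⇒x∈∁p)
open import Data.List.Base using (List; []; _∷_)
open import Data.List.Relation.Unary.Any using (satisfied)
open import Data.List.Relation.Unary.Any.Properties using (any⁻)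
open import Data.Nat.Base
open import Data.Nat.Properties renaming (_≟_ to _≟ℕ_)
open import Data.Nat.Solver using (module +-*-Solver)
open import Data.Product using (∃-syntax; _×_; _,_; proj₁; proj₂)
open import Data.Sum using (_⊎_; inj₁; inj₂) renaming (map to ⊎-map)
open import Data.Vec.Base using ([]; _∷_; lookup; tabulate)
open import Data.Vec.Properties
  using (≡-dec; lookup-zipWith; lookup-replicate; lookup-map; lookup∘tabulate; []=⇒lookup; lookup⇒[]=)
open import Defs hiding (sym)
open import Function.Base using (_∘_)
open import Function.Bundles using (Equivalence)
open import Relation.Binary.PropositionalEquality
open import Relation.Nullary using (Dec; yes; no; does; ¬_)
open import Relation.Nullary.Decidable using (dec-true; dec-false)

open Sum +-0-commutativeMonoid using (sum; ∑-distrib-+; ∑-comm; sum-cong-≗)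
open +-*-Solver using (solve; _:+_; _:=_; con)

infixr 3 _⇒ᵇ_

_⇒ᵇ_ : Bool → Bool → Bool
b ⇒ᵇ c = not b ∨ c

⇒ᵇ-intro : ∀ {b c} → (T b → T c) → T (b ⇒ᵇ c)
⇒ᵇ-intro {true} f = f _
⇒ᵇ-intro {false} f = _

⇒ᵇ-elim : ∀ {b c} → T (b ⇒ᵇ c) → T b → T c
⇒ᵇ-elim {true} h _ = h

T-∨-resolve : ∀ {a b} → T (a ∨ b) → ¬ T a → T b
T-∨-resolve {true} _ ¬a = ⊥-elim (¬a _)
T-∨-resolve {false} h _ = h

allᶠ : ∀ {k} → (Fin k → Bool) → Bool
allᶠ {zero} f = true
allᶠ {suc k} f = f zero ∧ allᶠ (f ∘ suc)

anyᶠ : ∀ {k} → (Fin k → Bool) → Bool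
anyᶠ {zero} f = false
anyᶠ {suc k} f = f zero ∨ anyᶠ (f ∘ suc)

allᶠ-intro : ∀ {k} {f : Fin k → Bool} → (∀ P → T (f P)) → T (allᶠ f)
allᶠ-intro {zero} all = _
allᶠ-intro {suc k} all = Equivalence.from T-∧ (all zero , allᶠ-intro (all ∘ suc))

allᶠ-elim : ∀ {k} {f : Fin k → Bool} → T (allᶠ f) → ∀ P → T (f P)
allᶠ-elim {suc k} h zero = proj₁ (Equivalence.to T-∧ h)
allᶠ-elim {suc k} h (suc P) = allᶠ-elim (proj₂ (Equivalence.to T-∧ h)) P

anyᶠ-intro : ∀ {k} {f : Fin k → Bool} P → T (f P) → T (anyᶠ f)
anyᶠ-intro zero h = Equivalence.from T-∨ (inj₁ h)
anyᶠ-intro (suc P) h = Equivalence.from T-∨ (inj₂ (anyᶠ-intro P h))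

anyᶠ-elim : ∀ {k} {f : Fin k → Bool} → T (anyᶠ f) → ∃[ P ] T (f P)
anyᶠ-elim {suc k} h with Equivalence.to T-∨ h
... | inj₁ h₀ = zero , h₀
... | inj₂ hₛ with anyᶠ-elim hₛ
...   | P , hₚ = suc P , hₚ

allᶠ-cong : ∀ {k} {f g : Fin k → Bool} → (∀ P → f P ≡ g P) → allᶠ f ≡ allᶠ g
allᶠ-cong {zero} _ = refl
allᶠ-cong {suc k} f≗g = cong₂ _∧_ (f≗g zero) (allᶠ-cong (f≗g ∘ suc))

anyᶠ-cong : ∀ {k} {f g : Fin k → Bool} → (∀ P → f P ≡ g P) → anyᶠ f ≡ anyᶠ g
anyᶠ-cong {zero} _ = refl
anyᶠ-cong {suc k} f≗g = cong₂ _∨_ (f≗g zero) (anyᶠ-cong (f≗g ∘ suc))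

infix 4 _≡ᶠ_

_≡ᶠ_ : ∀ {n} → Fin n → Fin n → Bool
i ≡ᶠ j = does (i ≟ j)

≡ᶠ-refl : ∀ {n} (i : Fin n) → (i ≡ᶠ i) ≡ true
≡ᶠ-refl i = dec-true (i ≟ i) refl

≡ᶠ-true : ∀ {n} {i j : Fin n} → (i ≡ᶠ j) ≡ true → i ≡ j
≡ᶠ-true {i = i} {j} i=j with i ≟ j
... | yes i≡j = i≡j

≡ᶠ-≢ : ∀ {n} {i j : Fin n} → i ≢ j → (i ≡ᶠ j) ≡ false
≡ᶠ-≢ {i = i} {j} = dec-false (i ≟ j)

≡ᶠ-false : ∀ {n} {i j : Fin n} → (i ≡ᶠ j) ≡ false → i ≢ j
≡ᶠ-false {i = i} i≠i refl with trans (sym i≠i) (≡ᶠ-refl i)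
... | ()

≡ᶠ-sym : ∀ {n} (i j : Fin n) → (i ≡ᶠ j) ≡ (j ≡ᶠ i)
≡ᶠ-sym i j with i ≟ j | j ≟ i
... | yes _ | yes _ = refl
... | no _ | no _ = refl
... | yes refl | no j≢i = ⊥-elim (j≢i refl)
... | no i≢j | yes refl = ⊥-elim (i≢j refl)

⟦_⟧ : Bool → ℕ
⟦ true ⟧ = 1
⟦ false ⟧ = 0

⟦⟧-split : ∀ b x → ⟦ x ⟧ ≡ ⟦ b ∧ x ⟧ + ⟦ not b ∧ x ⟧
⟦⟧-split true x = sym (+-identityʳ _)
⟦⟧-split false x = refl

count : ∀ {n} → (Fin n → Bool) → ℕ
count p = sum (λ i → ⟦ p i ⟧)

count-cong : ∀ {n} {p q : Fin n → Bool} → p ≗ q → count p ≡ count q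
count-cong p≗q = sum-cong-≗ (cong ⟦_⟧ ∘ p≗q)

count-split : ∀ {n} {p q r : Fin n → Bool} →
  (∀ i → ⟦ p i ⟧ ≡ ⟦ q i ⟧ + ⟦ r i ⟧) → count p ≡ count q + count r
count-split {q = q} {r} split =
  trans (sum-cong-≗ split) (∑-distrib-+ (λ i → ⟦ q i ⟧) (λ i → ⟦ r i ⟧))

count-exchange : ∀ {n} {p q r s : Fin n → Bool} →
  (∀ i → ⟦ p i ⟧ + ⟦ q i ⟧ ≡ ⟦ r i ⟧ + ⟦ s i ⟧) → count p + count q ≡ count r + count s
count-exchange {p = p} {q} {r} {s} pointwise = begin
  count p + count q                   ≡⟨ ∑-distrib-+ (λ i → ⟦ p i ⟧) (λ i → ⟦ q i ⟧) ⟨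
  sum (λ i → ⟦ p i ⟧ + ⟦ q i ⟧)       ≡⟨ sum-cong-≗ pointwise ⟩
  sum (λ i → ⟦ r i ⟧ + ⟦ s i ⟧)       ≡⟨ ∑-distrib-+ (λ i → ⟦ r i ⟧) (λ i → ⟦ s i ⟧) ⟩
  count r + count s                   ∎
  where open ≡-Reasoning

count-false : ∀ n → count {n} (λ _ → false) ≡ 0
count-false zero = refl
count-false (suc n) = count-false n

count-≡ᶠ : ∀ {n} (u : Fin n) (c : Fin n → Bool) → count (λ i → (i ≡ᶠ u) ∧ c i) ≡ ⟦ c u ⟧
count-≡ᶠ {suc n} zero c = trans (cong (⟦ c zero ⟧ +_) (count-false n)) (+-identityʳ _)
count-≡ᶠ (suc u) c = count-≡ᶠ u (c ∘ suc)

count-singleton : ∀ {n} (u : Fin n) → count (λ i → u ≡ᶠ i) ≡ 1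
count-singleton u =
  trans (count-cong λ i → trans (≡ᶠ-sym u i) (sym (∧-identityʳ (i ≡ᶠ u)))) (count-≡ᶠ u λ _ → true)

count-witness : ∀ {n} {p : Fin n → Bool} → 1 ≤ count p → ∃[ i ] p i ≡ true
count-witness {zero} ()
count-witness {suc n} {p} pos with p zero in p₀
... | true = zero , p₀
... | false with count-witness {p = p ∘ suc} pos
...   | i , pᵢ = suc i , pᵢ

count-member : ∀ {n} {p : Fin n → Bool} (i : Fin n) → p i ≡ true → 1 ≤ count p
count-member {p = p} zero pᵢ rewrite pᵢ = s≤s z≤n
count-member {p = p} (suc i) pᵢ = ≤-trans (count-member {p = p ∘ suc} i pᵢ) (m≤n+m _ ⟦ p zero ⟧)

count-remove : ∀ {n} (p : Fin n → Bool) (u : Fin n) →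
  count p ≡ ⟦ p u ⟧ + count (λ i → not (i ≡ᶠ u) ∧ p i)
count-remove p u =
  trans (count-split (λ i → ⟦⟧-split (i ≡ᶠ u) (p i)))
        (cong (_+ count (λ i → not (i ≡ᶠ u) ∧ p i)) (count-≡ᶠ u p))

count-two : ∀ {n} {p : Fin n → Bool} {u v : Fin n} → u ≢ v → p u ≡ true → p v ≡ true → 2 ≤ count p
count-two {p = p} {u} {v} u≢v pᵤ pᵥ rewrite count-remove p u | pᵤ =
  s≤s (count-member v (trans (cong (_∧ p v) (cong not (≡ᶠ-≢ (≢-sym u≢v)))) pᵥ))

count-two-witness : ∀ {n} {p : Fin n → Bool} → 2 ≤ count p →
  ∃[ u ] ∃[ v ] (u ≢ v × p u ≡ true × p v ≡ true)
count-two-witness {p = p} 2≤count with count-witness (≤-trans (s≤s z≤n) 2≤count)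
... | u , pᵤ = second (count-witness (s≤s⁻¹ (subst (2 ≤_) split 2≤count)))
  where
  others : Fin _ → Bool
  others i = not (i ≡ᶠ u) ∧ p i
  split : count p ≡ 1 + count others
  split = trans (count-remove p u) (cong (λ b → ⟦ b ⟧ + count others) pᵤ)
  second : ∃[ v ] others v ≡ true → ∃[ u ] ∃[ v ] (u ≢ v × p u ≡ true × p v ≡ true)
  second (v , otherᵥ) with v ≡ᶠ u in v≠u | p v in pᵥ
  ... | false | true = u , v , ≡ᶠ-false v≠u ∘ sym , pᵤ , pᵥ

∣∣≡count : ∀ {n} (S : Subset n) → ∣ S ∣ ≡ count (lookup S)
∣∣≡count [] = refl
∣∣≡count (true ∷ S) = cong suc (∣∣≡count S)
∣∣≡count (false ∷ S) = ∣∣≡count S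

firsts : ∀ {n} → ℕ → (Fin n → Bool) → Fin n → Bool
firsts k p zero = p zero ∧ (1 ≤ᵇ k)
firsts k p (suc i) = firsts (if p zero then k ∸ 1 else k) (p ∘ suc) i

firsts⇒ : ∀ {n} k (p : Fin n → Bool) i → firsts k p i ≡ true → p i ≡ true
firsts⇒ k p zero h with p zero
... | true = refl
firsts⇒ k p (suc i) h = firsts⇒ _ (p ∘ suc) i h

count-firsts : ∀ {n} k (p : Fin n → Bool) → k ≤ count p → count (firsts k p) ≡ k
count-firsts {zero} zero p _ = refl
count-firsts {suc n} k p k≤ with p zero
count-firsts {suc n} zero p k≤ | true = count-firsts zero (p ∘ suc) z≤n
count-firsts {suc n} (suc k) p (s≤s k≤) | true = cong suc (count-firsts k (p ∘ suc) k≤)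
... | false = count-firsts k (p ∘ suc) k≤

lookup⇒∈ : ∀ {n} {p : Subset n} {i} → lookup p i ≡ true → i ∈ p
lookup⇒∈ {p = p} {i} = lookup⇒[]= i p

∉⇒lookup : ∀ {n} {p : Subset n} {i} → i ∉ p → lookup p i ≡ false
∉⇒lookup {p = p} {i} i∉p with lookup p i in pᵢ
... | true = ⊥-elim (i∉p (lookup⇒∈ pᵢ))
... | false = refl

lookup⇒∉ : ∀ {n} {p : Subset n} {i} → lookup p i ≡ false → i ∉ p
lookup⇒∉ pᵢ i∈p with trans (sym ([]=⇒lookup i∈p)) pᵢ
... | ()

lookup-─ : ∀ {n} (p q : Subset n) i → lookup (p ─ q) i ≡ lookup p i ∧ not (lookup q i)
lookup-─ (x ∷ p) (true ∷ q) zero = sym (∧-zeroʳ x)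
lookup-─ (x ∷ p) (false ∷ q) zero = sym (∧-identityʳ x)
lookup-─ (x ∷ p) (y ∷ q) (suc i) = lookup-─ p q i

lookup-⁅⁆ : ∀ {n} (u i : Fin n) → lookup ⁅ u ⁆ i ≡ (i ≡ᶠ u)
lookup-⁅⁆ zero zero = refl
lookup-⁅⁆ zero (suc i) = lookup-replicate i false
lookup-⁅⁆ (suc u) zero = refl
lookup-⁅⁆ (suc u) (suc i) = lookup-⁅⁆ u i

lookup-swap : ∀ {n} (S : Subset n) u v i →
  lookup ((S - u) ∪ ⁅ v ⁆) i ≡ (lookup S i ∧ not (i ≡ᶠ u)) ∨ (i ≡ᶠ v)
lookup-swap S u v i = trans (lookup-zipWith _∨_ i (S - u) ⁅ v ⁆)
  (cong₂ _∨_ (trans (lookup-─ S ⁅ u ⁆ i) (cong (λ b → lookup S i ∧ not b) (lookup-⁅⁆ u i))) (lookup-⁅⁆ v i))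

-- Cosecure domination sees class counts only up to 2, and the claimed values only up to 4; this
-- relation records such agreement, so that each finite check may replace counts by capped ones.
infix 4 _≈[_]_

_≈[_]_ : ℕ → ℕ → ℕ → Set
x ≈[ K ] y = x ≡ y ⊎ (K ≤ x × K ≤ y)

≈-refl : ∀ {K x} → x ≈[ K ] x
≈-refl = inj₁ refl

≈-sym : ∀ {K x y} → x ≈[ K ] y → y ≈[ K ] x
≈-sym (inj₁ x≡y) = inj₁ (sym x≡y)
≈-sym (inj₂ (K≤x , K≤y)) = inj₂ (K≤y , K≤x)

≈-weaken : ∀ {K K′ x y} → K′ ≤ K → x ≈[ K ] y → x ≈[ K′ ] y
≈-weaken _ (inj₁ x≡y) = inj₁ x≡y
≈-weaken K′≤K (inj₂ (K≤x , K≤y)) = inj₂ (≤-trans K′≤K K≤x , ≤-trans K′≤K K≤y)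

≈-+ : ∀ {K x y x′ y′} → x ≈[ K ] y → x′ ≈[ K ] y′ → x + x′ ≈[ K ] y + y′
≈-+ (inj₁ refl) (inj₁ refl) = inj₁ refl
≈-+ {x = x} {y} (inj₁ refl) (inj₂ (K≤x′ , K≤y′)) =
  inj₂ (≤-trans K≤x′ (m≤n+m _ x) , ≤-trans K≤y′ (m≤n+m _ x))
≈-+ {x′ = x′} {y′} (inj₂ (K≤x , K≤y)) _ = inj₂ (≤-trans K≤x (m≤m+n _ x′) , ≤-trans K≤y (m≤m+n _ y′))

≈-∸ : ∀ {K x y} c → x ≈[ K + c ] y → x ∸ c ≈[ K ] y ∸ c
≈-∸ c (inj₁ refl) = inj₁ refl
≈-∸ {K} c (inj₂ (≤x , ≤y)) = inj₂ (m+n≤o⇒m≤o∸n K ≤x , m+n≤o⇒m≤o∸n K ≤y)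

≈-⊓ : ∀ K x → x ≈[ K ] K ⊓ x
≈-⊓ K x with ≤-total x K
... | inj₁ x≤K = inj₁ (sym (m≥n⇒m⊓n≡n x≤K))
... | inj₂ K≤x = inj₂ (K≤x , ≤-reflexive (sym (m≤n⇒m⊓n≡m K≤x)))

⊓-≈ : ∀ {K c x y} → c ≤ K → x ≈[ K ] y → c ⊓ x ≡ c ⊓ y
⊓-≈ _ (inj₁ refl) = refl
⊓-≈ c≤K (inj₂ (K≤x , K≤y)) = trans (m≤n⇒m⊓n≡m (≤-trans c≤K K≤x)) (sym (m≤n⇒m⊓n≡m (≤-trans c≤K K≤y)))

≤ᵇ-≈ : ∀ {K x y} t → t < K → x ≈[ K ] y → (x ≤ᵇ t) ≡ (y ≤ᵇ t)
≤ᵇ-≈ t _ (inj₁ refl) = refl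
≤ᵇ-≈ {x = x} {y} t t<K (inj₂ (K≤x , K≤y)) =
  trans (above x (<-≤-trans t<K K≤x)) (sym (above y (<-≤-trans t<K K≤y)))
  where
  above : ∀ z → t < z → (z ≤ᵇ t) ≡ false
  above z t<z with z ≤ᵇ t in z≤t
  ... | false = refl
  ... | true = ⊥-elim (<⇒≱ t<z (≤ᵇ⇒≤ z t (Equivalence.from T-≡ z≤t)))

≥ᵇ-≈ : ∀ {K x y} t → t ≤ K → x ≈[ K ] y → (t ≤ᵇ x) ≡ (t ≤ᵇ y)
≥ᵇ-≈ t _ (inj₁ refl) = refl
≥ᵇ-≈ {x = x} {y} t t≤K (inj₂ (K≤x , K≤y)) =
  trans (Equivalence.to T-≡ (≤⇒≤ᵇ (≤-trans t≤K K≤x))) (sym (Equivalence.to T-≡ (≤⇒≤ᵇ (≤-trans t≤K K≤y))))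

all≤ᵇ : ℕ → (ℕ → Bool) → Bool
all≤ᵇ zero f = f zero
all≤ᵇ (suc K) f = f (suc K) ∧ all≤ᵇ K f

all≤ᵇ-sound : ∀ K {f : ℕ → Bool} → T (all≤ᵇ K f) → ∀ {x} → x ≤ K → T (f x)
all≤ᵇ-sound zero h z≤n = h
all≤ᵇ-sound (suc K) {f} h {x} x≤K with x ≟ℕ suc K
... | yes refl = proj₁ (Equivalence.to T-∧ h)
... | no x≢K = all≤ᵇ-sound K (proj₂ (Equivalence.to T-∧ h)) (s≤s⁻¹ (≤∧≢⇒< x≤K x≢K))

Profile : ℕ → Set
Profile k = Fin k → ℕ

≤-sum : ∀ {k} (p : Profile k) P → p P ≤ sum p
≤-sum p zero = m≤m+n (p zero) _
≤-sum p (suc P) = ≤-trans (≤-sum (p ∘ suc) P) (m≤n+m _ (p zero))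

infix 4 _≋[_]_

_≋[_]_ : ∀ {k} → Profile k → ℕ → Profile k → Set
p ≋[ K ] q = ∀ P → p P ≈[ K ] q P

≋-weaken : ∀ {k K K′} {p q : Profile k} → K′ ≤ K → p ≋[ K ] q → p ≋[ K′ ] q
≋-weaken K′≤K p≋q = ≈-weaken K′≤K ∘ p≋q

nonzero : ℕ → Bool
nonzero x = 1 ≤ᵇ x

nonzero-≈ : ∀ {x y} → x ≈[ 1 ] y → nonzero x ≡ nonzero y
nonzero-≈ = ≥ᵇ-≈ 1 ≤-refl

nonzero-count⇒ : ∀ {n} {p : Fin n → Bool} → T (nonzero (count p)) → ∃[ i ] p i ≡ true
nonzero-count⇒ {p = p} = count-witness ∘ ≤ᵇ⇒≤ 1 (count p)

⇒nonzero-count : ∀ {n} {p : Fin n → Bool} i → p i ≡ true → T (nonzero (count p))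
⇒nonzero-count i pᵢ = ≤⇒≤ᵇ (count-member i pᵢ)

module Profiles {k : ℕ} (H : Fin k → Fin k → Bool) where

  -- s P and m P count the vertices of class P inside and outside the set.  When one vertex of class P
  -- leaves the set and one of class Q enters it, the counts become shift s P Q and shift m Q P.
  shift : Profile k → Fin k → Fin k → Profile k
  shift p P Q X = (p X + ⟦ Q ≡ᶠ X ⟧) ∸ ⟦ P ≡ᶠ X ⟧

  Dominatesᵇ : Profile k → Profile k → Bool
  Dominatesᵇ s m = allᶠ λ P → nonzero (m P) ⇒ᵇ anyᶠ λ Q → H P Q ∧ nonzero (s Q)

  Cosecureᵇ : Profile k → Profile k → Bool
  Cosecureᵇ s m = Dominatesᵇ s m ∧ allᶠ λ P → nonzero (s P) ⇒ᵇ anyᶠ λ Q →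
    H P Q ∧ (nonzero (m Q) ∧ Dominatesᵇ (shift s P Q) (shift m Q P))

  ProfileGammaCS : Profile k → ℕ → Set
  ProfileGammaCS z γ =
    (∀ s m → (∀ P → s P + m P ≡ z P) → T (Cosecureᵇ s m) → γ ≤ sum s) ×
    (∃[ s ] ∃[ m ] ((∀ P → s P + m P ≡ z P) × T (Cosecureᵇ s m) × sum s ≡ γ))

  Dominatesᵇ-≈ : ∀ {s m s′ m′} → s ≋[ 1 ] s′ → m ≋[ 1 ] m′ →
    Dominatesᵇ s m ≡ Dominatesᵇ s′ m′
  Dominatesᵇ-≈ s≈ m≈ = allᶠ-cong λ P →
    cong₂ _⇒ᵇ_ (nonzero-≈ (m≈ P)) (anyᶠ-cong λ Q → cong (H P Q ∧_) (nonzero-≈ (s≈ Q)))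

  shift-≈ : ∀ {p p′} → p ≋[ 2 ] p′ → ∀ P Q → shift p P Q ≋[ 1 ] shift p′ P Q
  shift-≈ p≈ P Q X = ≈-∸ ⟦ P ≡ᶠ X ⟧ (≈-weaken (1+⟦⟧≤2 (P ≡ᶠ X)) (≈-+ (p≈ X) ≈-refl))
    where
    1+⟦⟧≤2 : ∀ b → 1 + ⟦ b ⟧ ≤ 2
    1+⟦⟧≤2 true = ≤-refl
    1+⟦⟧≤2 false = s≤s z≤n

  Cosecureᵇ-≈ : ∀ {s m s′ m′} → s ≋[ 2 ] s′ → m ≋[ 2 ] m′ →
    Cosecureᵇ s m ≡ Cosecureᵇ s′ m′
  Cosecureᵇ-≈ s≈ m≈ = cong₂ _∧_ (Dominatesᵇ-≈ (≋-weaken (s≤s z≤n) s≈) (≋-weaken (s≤s z≤n) m≈))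
    (allᶠ-cong λ P → cong₂ _⇒ᵇ_ (nonzero-≈ (≈-weaken (s≤s z≤n) (s≈ P)))
      (anyᶠ-cong λ Q → cong (H P Q ∧_) (cong₂ _∧_ (nonzero-≈ (≈-weaken (s≤s z≤n) (m≈ Q)))
        (Dominatesᵇ-≈ (shift-≈ s≈ P Q) (shift-≈ m≈ Q P)))))

swap-indicator : ∀ s eu ev → (eu ≡ true → s ≡ true × ev ≡ false) → (ev ≡ true → s ≡ false) →
  let s′ = (s ∧ not eu) ∨ ev in
  (⟦ s′ ⟧ + ⟦ eu ⟧ ≡ ⟦ s ⟧ + ⟦ ev ⟧) × (⟦ not s′ ⟧ + ⟦ ev ⟧ ≡ ⟦ not s ⟧ + ⟦ eu ⟧)
swap-indicator s true ev atU atV with atU refl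
... | refl , refl = refl , refl
swap-indicator s false true atU atV with atV refl
... | refl = refl , refl
swap-indicator true false false atU atV = refl , refl
swap-indicator false false false atU atV = refl , refl

indicator-mask : ∀ a b d e c → ⟦ a ⟧ + ⟦ b ⟧ ≡ ⟦ d ⟧ + ⟦ e ⟧ →
  ⟦ a ∧ c ⟧ + ⟦ b ∧ c ⟧ ≡ ⟦ d ∧ c ⟧ + ⟦ e ∧ c ⟧
indicator-mask a b d e false _ rewrite ∧-zeroʳ a | ∧-zeroʳ b | ∧-zeroʳ d | ∧-zeroʳ e = refl
indicator-mask a b d e true eq rewrite ∧-identityʳ a | ∧-identityʳ b | ∧-identityʳ d | ∧-identityʳ e = eq

module BlowUp {n k : ℕ} (G : Graph n) (Z : Subset n) (H : Fin k → Fin k → Bool) (classOf : Fin n → Fin k)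
  (adj-class : ∀ {u v} → u ∈ Z → v ∈ Z → adj G u v ≡ H (classOf u) (classOf v)) where

  open Profiles H

  inClass : Fin k → Fin n → Bool
  inClass P i = lookup Z i ∧ (classOf i ≡ᶠ P)

  classSize : Profile k
  classSize P = count (inClass P)

  selected : Subset n → Profile k
  selected S P = count λ i → lookup S i ∧ inClass P i

  unselected : Subset n → Profile k
  unselected S P = count λ i → not (lookup S i) ∧ inClass P i

  selected+unselected : ∀ S P → selected S P + unselected S P ≡ classSize P
  selected+unselected S P = sym (count-split λ i → ⟦⟧-split (lookup S i) (inClass P i))

  class-member : ∀ {b P i} → (b ∧ inClass P i) ≡ true → b ≡ true × i ∈ Z × classOf i ≡ P
  class-member {true} {P} {i} h with lookup Z i in zᵢ
  ... | true = refl , lookup⇒∈ zᵢ , ≡ᶠ-true h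

  in-own-class : ∀ {b i} → b ≡ true → i ∈ Z → (b ∧ inClass (classOf i) i) ≡ true
  in-own-class {i = i} refl i∈Z rewrite []=⇒lookup i∈Z = ≡ᶠ-refl (classOf i)

  selected-witness : ∀ {S P} → T (nonzero (selected S P)) → ∃[ u ] (u ∈ S × u ∈ Z × classOf u ≡ P)
  selected-witness nz with nonzero-count⇒ nz
  ... | u , h with class-member h
  ...   | Sᵤ , u∈Z , tᵤ = u , lookup⇒∈ Sᵤ , u∈Z , tᵤ

  unselected-witness : ∀ {S P} → T (nonzero (unselected S P)) → ∃[ v ] (v ∉ S × v ∈ Z × classOf v ≡ P)
  unselected-witness {S} nz with nonzero-count⇒ nz
  ... | v , h with class-member {not (lookup S v)} h
  ...   | ¬Sᵥ , v∈Z , tᵥ = v , lookup⇒∉ (trans (sym (not-involutive _)) (cong not ¬Sᵥ)) , v∈Z , tᵥ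

  selected-nonzero : ∀ {S u} → u ∈ S → u ∈ Z → T (nonzero (selected S (classOf u)))
  selected-nonzero {u = u} u∈S u∈Z = ⇒nonzero-count u (in-own-class ([]=⇒lookup u∈S) u∈Z)

  unselected-nonzero : ∀ {S v} → v ∉ S → v ∈ Z → T (nonzero (unselected S (classOf v)))
  unselected-nonzero {v = v} v∉S v∈Z = ⇒nonzero-count v (in-own-class (cong not (∉⇒lookup v∉S)) v∈Z)

  edge⇒H : ∀ {u v} → u ∈ Z → v ∈ Z → Edge G u v → T (H (classOf u) (classOf v))
  edge⇒H u∈Z v∈Z uv = Equivalence.from T-≡ (trans (sym (adj-class u∈Z v∈Z)) uv)

  H⇒edge : ∀ {u v} → u ∈ Z → v ∈ Z → T (H (classOf u) (classOf v)) → Edge G u v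
  H⇒edge u∈Z v∈Z h = trans (adj-class u∈Z v∈Z) (Equivalence.to T-≡ h)

  dominating⇒ᵇ : ∀ {S} → S ⊆ Z → DominatingIn G Z S → T (Dominatesᵇ (selected S) (unselected S))
  dominating⇒ᵇ {S} S⊆Z dom = allᶠ-intro λ P → ⇒ᵇ-intro λ nzm → dominated-class (unselected-witness {S} {P} nzm)
    where
    dominated-class : ∀ {P} → ∃[ v ] (v ∉ S × v ∈ Z × classOf v ≡ P) →
      T (anyᶠ λ Q → H P Q ∧ nonzero (selected S Q))
    dominated-class (v , v∉S , v∈Z , refl) with dom v v∈Z v∉S
    ... | u , u∈S , uv = anyᶠ-intro (classOf u) (Equivalence.from T-∧
      (edge⇒H v∈Z (S⊆Z u∈S) (trans (Graph.sym G v u) uv) , selected-nonzero u∈S (S⊆Z u∈S)))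

  ᵇ⇒dominating : ∀ {S} → T (Dominatesᵇ (selected S) (unselected S)) → DominatingIn G Z S
  ᵇ⇒dominating {S} h v v∈Z v∉S with anyᶠ-elim (⇒ᵇ-elim (allᶠ-elim h (classOf v)) (unselected-nonzero v∉S v∈Z))
  ... | Q , hQ with Equivalence.to T-∧ hQ
  ...   | HvQ , nzs with selected-witness {S} {Q} nzs
  ...     | u , u∈S , u∈Z , refl = u , u∈S , trans (Graph.sym G u v) (H⇒edge v∈Z u∈Z HvQ)

  module Swap {S u v} (u∈S : u ∈ S) (v∉S : v ∉ S) (u∈Z : u ∈ Z) (v∈Z : v ∈ Z) where

    S′ : Subset n
    S′ = (S - u) ∪ ⁅ v ⁆

    swap-pointwise : ∀ i →
      (⟦ lookup S′ i ⟧ + ⟦ i ≡ᶠ u ⟧ ≡ ⟦ lookup S i ⟧ + ⟦ i ≡ᶠ v ⟧) ×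
      (⟦ not (lookup S′ i) ⟧ + ⟦ i ≡ᶠ v ⟧ ≡ ⟦ not (lookup S i) ⟧ + ⟦ i ≡ᶠ u ⟧)
    swap-pointwise i rewrite lookup-swap S u v i = swap-indicator (lookup S i) (i ≡ᶠ u) (i ≡ᶠ v) atU atV
      where
      atU : (i ≡ᶠ u) ≡ true → lookup S i ≡ true × (i ≡ᶠ v) ≡ false
      atU i=u with ≡ᶠ-true {i = i} {u} i=u
      ... | refl = []=⇒lookup u∈S , ≡ᶠ-≢ (λ u≡v → v∉S (subst (_∈ S) u≡v u∈S))
      atV : (i ≡ᶠ v) ≡ true → lookup S i ≡ false
      atV i=v with ≡ᶠ-true {i = i} {v} i=v
      ... | refl = ∉⇒lookup v∉S

    count-at : ∀ {w} → w ∈ Z → ∀ X → count (λ i → (i ≡ᶠ w) ∧ inClass X i) ≡ ⟦ classOf w ≡ᶠ X ⟧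
    count-at {w} w∈Z X rewrite count-≡ᶠ w (inClass X) | []=⇒lookup w∈Z = refl

    shifted : ∀ {a b} p q → a + ⟦ p ⟧ ≡ b + ⟦ q ⟧ → a ≡ (b + ⟦ q ⟧) ∸ ⟦ p ⟧
    shifted {a} p q eq = trans (sym (m+n∸n≡m a ⟦ p ⟧)) (cong (_∸ ⟦ p ⟧) eq)

    selected-swap : ∀ X → selected S′ X ≡ shift (selected S) (classOf u) (classOf v) X
    selected-swap X = shifted (classOf u ≡ᶠ X) (classOf v ≡ᶠ X) (begin
      selected S′ X + ⟦ classOf u ≡ᶠ X ⟧
        ≡⟨ cong (selected S′ X +_) (count-at u∈Z X) ⟨
      selected S′ X + count (λ i → (i ≡ᶠ u) ∧ inClass X i)
        ≡⟨ count-exchange (λ i → indicator-mask (lookup S′ i) (i ≡ᶠ u) (lookup S i) (i ≡ᶠ v) (inClass X i)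
                                              (proj₁ (swap-pointwise i))) ⟩
      selected S X + count (λ i → (i ≡ᶠ v) ∧ inClass X i)
        ≡⟨ cong (selected S X +_) (count-at v∈Z X) ⟩
      selected S X + ⟦ classOf v ≡ᶠ X ⟧ ∎)
      where open ≡-Reasoning

    unselected-swap : ∀ X → unselected S′ X ≡ shift (unselected S) (classOf v) (classOf u) X
    unselected-swap X = shifted (classOf v ≡ᶠ X) (classOf u ≡ᶠ X) (begin
      unselected S′ X + ⟦ classOf v ≡ᶠ X ⟧
        ≡⟨ cong (unselected S′ X +_) (count-at v∈Z X) ⟨
      unselected S′ X + count (λ i → (i ≡ᶠ v) ∧ inClass X i)
        ≡⟨ count-exchange (λ i → indicator-mask (not (lookup S′ i)) (i ≡ᶠ v) (not (lookup S i)) (i ≡ᶠ u)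
                                                (inClass X i)
                                              (proj₂ (swap-pointwise i))) ⟩
      unselected S X + count (λ i → (i ≡ᶠ u) ∧ inClass X i)
        ≡⟨ cong (unselected S X +_) (count-at u∈Z X) ⟩
      unselected S X + ⟦ classOf u ≡ᶠ X ⟧ ∎)
      where open ≡-Reasoning

    Dominatesᵇ-swap : Dominatesᵇ (selected S′) (unselected S′) ≡
      Dominatesᵇ (shift (selected S) (classOf u) (classOf v)) (shift (unselected S) (classOf v) (classOf u))
    Dominatesᵇ-swap = Dominatesᵇ-≈ (inj₁ ∘ selected-swap) (inj₁ ∘ unselected-swap)

    swap-⊆ : S ⊆ Z → S′ ⊆ Z
    swap-⊆ S⊆Z {x} x∈S′
      with lookup S x in Sₓ | x ≡ᶠ v in x=v | trans (sym (lookup-swap S u v x)) ([]=⇒lookup x∈S′)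
    ... | true | _ | _ = S⊆Z (lookup⇒∈ Sₓ)
    ... | false | true | _ with ≡ᶠ-true {i = x} {v} x=v
    ...   | refl = v∈Z

  cosecure⇒ᵇ : ∀ {S} → CosecureDominatingIn G Z S → T (Cosecureᵇ (selected S) (unselected S))
  cosecure⇒ᵇ {S} (S⊆Z , dom , cos) = Equivalence.from T-∧
    (dominating⇒ᵇ S⊆Z dom , allᶠ-intro λ P → ⇒ᵇ-intro λ nzs → swappable (selected-witness {S} {P} nzs))
    where
    swappable : ∀ {P} → ∃[ u ] (u ∈ S × u ∈ Z × classOf u ≡ P) → T (anyᶠ λ Q → H P Q ∧
      (nonzero (unselected S Q) ∧ Dominatesᵇ (shift (selected S) P Q) (shift (unselected S) Q P)))
    swappable (u , u∈S , u∈Z , refl) with cos u u∈S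
    ... | v , v∈Z , v∉S , uv , dom′ = anyᶠ-intro (classOf v) (Equivalence.from T-∧ (edge⇒H u∈Z v∈Z uv ,
          Equivalence.from T-∧ (unselected-nonzero v∉S v∈Z ,
            subst T Dominatesᵇ-swap (dominating⇒ᵇ (swap-⊆ S⊆Z) dom′))))
      where open Swap u∈S v∉S u∈Z v∈Z

  ᵇ⇒cosecure : ∀ {S} → S ⊆ Z → T (Cosecureᵇ (selected S) (unselected S)) → CosecureDominatingIn G Z S
  ᵇ⇒cosecure {S} S⊆Z h with Equivalence.to (T-∧ {Dominatesᵇ (selected S) (unselected S)}) h
  ... | dominates , swaps = S⊆Z , ᵇ⇒dominating dominates , swap
    where
    swap : ∀ u → u ∈ S → ∃[ v ] (v ∈ Z × v ∉ S × Edge G u v × DominatingIn G Z ((S - u) ∪ ⁅ v ⁆))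
    swap u u∈S with anyᶠ-elim (⇒ᵇ-elim (allᶠ-elim swaps (classOf u)) (selected-nonzero u∈S (S⊆Z u∈S)))
    ... | Q , hQ with Equivalence.to (T-∧ {H (classOf u) Q}) hQ
    ...   | HuQ , hQ′ with Equivalence.to (T-∧ {nonzero (unselected S Q)}) hQ′
    ...     | nzm , dom′ with unselected-witness {S} {Q} nzm
    ...       | v , v∉S , v∈Z , refl = v , v∈Z , v∉S , H⇒edge (S⊆Z u∈S) v∈Z HuQ ,
                ᵇ⇒dominating (subst T (sym Dominatesᵇ-swap) dom′)
      where open Swap u∈S v∉S (S⊆Z u∈S) v∈Z

  ∣∣≡sum-selected : ∀ {S} → S ⊆ Z → ∣ S ∣ ≡ sum (selected S)
  ∣∣≡sum-selected {S} S⊆Z = begin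
    ∣ S ∣                                                   ≡⟨ ∣∣≡count S ⟩
    count (lookup S)                                        ≡⟨ sum-cong-≗ split-by-class ⟩
    sum (λ i → sum (λ P → ⟦ lookup S i ∧ inClass P i ⟧))    ≡⟨ ∑-comm (λ i P → ⟦ lookup S i ∧ inClass P i ⟧) ⟩
    sum (selected S)                                        ∎
    where
    open ≡-Reasoning
    split-by-class : ∀ i → ⟦ lookup S i ⟧ ≡ count (λ P → lookup S i ∧ inClass P i)
    split-by-class i with lookup S i in Sᵢ
    ... | false = sym (count-false k)
    ... | true rewrite []=⇒lookup (S⊆Z (lookup⇒∈ Sᵢ)) = sym (count-singleton (classOf i))

  realise : ∀ (s : Profile k) → (∀ P → s P ≤ classSize P) → ∃[ S ] (S ⊆ Z × ∀ P → selected S P ≡ s P)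
  realise s s≤ = S , S⊆Z , λ P → trans (count-cong (pointwise P)) (count-firsts (s P) (inClass P) (s≤ P))
    where
    S : Subset n
    S = tabulate λ i → firsts (s (classOf i)) (inClass (classOf i)) i
    S-spec : ∀ i → lookup S i ≡ firsts (s (classOf i)) (inClass (classOf i)) i
    S-spec = lookup∘tabulate λ i → firsts (s (classOf i)) (inClass (classOf i)) i
    S⊆Z : S ⊆ Z
    S⊆Z {i} i∈S
      with lookup Z i in zᵢ | firsts⇒ (s (classOf i)) (inClass (classOf i)) i (trans (sym (S-spec i)) ([]=⇒lookup i∈S))
    ... | true | _ = lookup⇒∈ zᵢ
    pointwise : ∀ P i → (lookup S i ∧ inClass P i) ≡ firsts (s P) (inClass P) i
    pointwise P i = trans (cong (_∧ inClass P i) (S-spec i)) (by-class P i)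
      where
      by-class : ∀ P i →
        (firsts (s (classOf i)) (inClass (classOf i)) i ∧ inClass P i) ≡ firsts (s P) (inClass P) i
      by-class P i with classOf i ≟ P
      ... | yes refl = absorb λ f → subst (λ b → lookup Z i ∧ b ≡ true) (≡ᶠ-refl (classOf i))
                                         (firsts⇒ (s (classOf i)) (inClass (classOf i)) i f)
        where
        absorb : ∀ {b c} → (b ≡ true → c ≡ true) → b ∧ c ≡ b
        absorb {false} _ = refl
        absorb {true} b⇒c = b⇒c refl
      ... | no tᵢ≢P = trans (cong (firsts (s (classOf i)) (inClass (classOf i)) i ∧_) (∧-zeroʳ (lookup Z i)))
                            (trans (∧-zeroʳ _) (sym (excluded (firsts⇒ (s P) (inClass P) i) outside)))
        where
        outside : inClass P i ≡ false
        outside = trans (cong (lookup Z i ∧_) (≡ᶠ-≢ tᵢ≢P)) (∧-zeroʳ (lookup Z i))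
        excluded : ∀ {b c} → (b ≡ true → c ≡ true) → c ≡ false → b ≡ false
        excluded {false} _ _ = refl
        excluded {true} b⇒c c≡false = trans (sym (b⇒c refl)) c≡false

  GammaCSIn-fromProfile : ∀ {γ} → ProfileGammaCS classSize γ → GammaCSIn G Z γ
  GammaCSIn-fromProfile {γ} (lower , s , m , s+m , cos , Σs)
    with realise s (λ P → subst (s P ≤_) (s+m P) (m≤m+n (s P) (m P)))
  ... | S , S⊆Z , sel = (S , ᵇ⇒cosecure S⊆Z (subst T (Cosecureᵇ-≈ s≈ m≈) cos) , size) , minimal
    where
    s≈ : s ≋[ 2 ] selected S
    s≈ P = inj₁ (sym (sel P))
    m≈ : m ≋[ 2 ] unselected S
    m≈ P = inj₁ (+-cancelˡ-≡ (s P) _ _ (trans (s+m P)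
             (trans (sym (selected+unselected S P)) (cong (_+ unselected S P) (sel P)))))
    size : ∣ S ∣ ≡ γ
    size = trans (∣∣≡sum-selected S⊆Z) (trans (sum-cong-≗ sel) Σs)
    minimal : ∀ S′ → CosecureDominatingIn G Z S′ → γ ≤ ∣ S′ ∣
    minimal S′ cs = subst (γ ≤_) (sym (∣∣≡sum-selected (proj₁ cs)))
      (lower (selected S′) (unselected S′) (selected+unselected S′) (cosecure⇒ᵇ cs))

pattern X₁ = zero
pattern X₂ = suc zero
pattern Y₁ = suc (suc zero)
pattern Y₂ = suc (suc (suc zero))

P₄ : Fin 4 → Fin 4 → Bool
P₄ X₁ Y₁ = true
P₄ Y₁ X₁ = true
P₄ X₂ Y₁ = true
P₄ Y₁ X₂ = true
P₄ X₂ Y₂ = true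
P₄ Y₂ X₂ = true
P₄ _ _ = false

open Profiles P₄

profile : ℕ → ℕ → ℕ → ℕ → Profile 4
profile a b c d X₁ = a
profile a b c d X₂ = b
profile a b c d Y₁ = c
profile a b c d Y₂ = d

uniform : ℕ → Profile 4
uniform K _ = K

_⊕_ : Profile 4 → Profile 4 → Profile 4
(s ⊕ m) P = s P + m P

_⊖_ : Profile 4 → Profile 4 → Profile 4
(z ⊖ s) P = z P ∸ s P

⊕-≈ : ∀ {K s m s′ m′} → s ≋[ K ] s′ → m ≋[ K ] m′ → s ⊕ m ≋[ K ] s′ ⊕ m′
⊕-≈ s≈ m≈ P = ≈-+ (s≈ P) (m≈ P)

sum-profile : ∀ a b c d → sum (profile a b c d) ≡ (a + c) + (b + d)
sum-profile = solve 4 (λ a b c d → a :+ (b :+ (c :+ (d :+ con 0))) := (a :+ c) :+ (b :+ d)) refl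

capped : Profile 4 → Profile 4 → Profile 4
capped b p = profile (b X₁ ⊓ p X₁) (b X₂ ⊓ p X₂) (b Y₁ ⊓ p Y₁) (b Y₂ ⊓ p Y₂)

capped-spec : ∀ b p P → capped b p P ≡ b P ⊓ p P
capped-spec b p X₁ = refl
capped-spec b p X₂ = refl
capped-spec b p Y₁ = refl
capped-spec b p Y₂ = refl

capped-≈ : ∀ {K} b p → (∀ P → K ≤ b P) → p ≋[ K ] capped b p
capped-≈ b p K≤b P =
  subst (p P ≈[ _ ]_) (sym (capped-spec b p P)) (≈-weaken (K≤b P) (≈-⊓ (b P) (p P)))

capped-≤ : ∀ b p P → capped b p P ≤ p P
capped-≤ b p P = subst (_≤ p P) (sym (capped-spec b p P)) (m⊓n≤n (b P) (p P))

capped-id : ∀ b p P → p P ≤ b P → capped b p P ≡ p P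
capped-id b p P p≤b = trans (capped-spec b p P) (m≥n⇒m⊓n≡n p≤b)

allProfilesᵇ : Profile 4 → (Profile 4 → Bool) → Bool
allProfilesᵇ b f =
  all≤ᵇ (b X₁) λ a → all≤ᵇ (b X₂) λ c → all≤ᵇ (b Y₁) λ d → all≤ᵇ (b Y₂) λ e → f (profile a c d e)

allProfilesᵇ-sound : ∀ b f → T (allProfilesᵇ b f) → ∀ p → T (f (capped b p))
allProfilesᵇ-sound b f h p =
  all≤ᵇ-sound (b Y₂) (all≤ᵇ-sound (b Y₁) (all≤ᵇ-sound (b X₂) (all≤ᵇ-sound (b X₁) h (m⊓n≤m _ _))
    (m⊓n≤m _ _)) (m⊓n≤m _ _)) (m⊓n≤m _ _)

Occupiedᵇ : Profile 4 → Bool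
Occupiedᵇ z = allᶠ λ P → 1 ≤ᵇ z P

-- A pendent vertex of X lies in X₁ with |Y₁| = 1, a pendent vertex of Y in Y₂ with |X₂| = 1.
FewPendentsᵇ : Profile 4 → Bool
FewPendentsᵇ z = Occupiedᵇ z ∧ ((2 ≤ᵇ z Y₁) ∨ (z X₁ ≤ᵇ 1)) ∧ ((2 ≤ᵇ z X₂) ∨ (z Y₂ ≤ᵇ 1))

partner : Fin 4 → Fin 4
partner X₁ = Y₁
partner X₂ = Y₂
partner Y₁ = X₁
partner Y₂ = X₂

partner-involutive : ∀ P → partner (partner P) ≡ P
partner-involutive X₁ = refl
partner-involutive X₂ = refl
partner-involutive Y₁ = refl
partner-involutive Y₂ = refl

inPair : Fin 4 → Fin 4 → Bool
inPair P X = (X ≡ᶠ P) ∨ (X ≡ᶠ partner P)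

OnlyPairᵇ : Fin 4 → Profile 4 → Bool
OnlyPairᵇ P z = allᶠ λ X → if inPair P X then 1 ≤ᵇ z X else z X ≤ᵇ 0

-- The profiles whose γ_cs splits as γ_cs(K_{X₁,Y₁}) + γ_cs(K_{X₂,Y₂}): many pendent vertices on one
-- side, or only one half X₁ ∪ Y₁ or X₂ ∪ Y₂ present.
Decomposableᵇ : Profile 4 → Bool
Decomposableᵇ z =
  (Occupiedᵇ z ∧ (((z Y₁ ≤ᵇ 1) ∧ (2 ≤ᵇ z X₁)) ∨ ((z X₂ ≤ᵇ 1) ∧ (2 ≤ᵇ z Y₂)))) ∨
  OnlyPairᵇ X₁ z ∨ OnlyPairᵇ X₂ z

Occupiedᵇ-≈ : ∀ {z z′} → z ≋[ 1 ] z′ → Occupiedᵇ z ≡ Occupiedᵇ z′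
Occupiedᵇ-≈ z≈ = allᶠ-cong λ P → ≥ᵇ-≈ 1 ≤-refl (z≈ P)

FewPendentsᵇ-≈ : ∀ {z z′} → z ≋[ 2 ] z′ → FewPendentsᵇ z ≡ FewPendentsᵇ z′
FewPendentsᵇ-≈ z≈ = cong₂ _∧_ (Occupiedᵇ-≈ (≋-weaken (s≤s z≤n) z≈)) (cong₂ _∧_
  (cong₂ _∨_ (≥ᵇ-≈ 2 ≤-refl (z≈ Y₁)) (≤ᵇ-≈ 1 ≤-refl (z≈ X₁)))
  (cong₂ _∨_ (≥ᵇ-≈ 2 ≤-refl (z≈ X₂)) (≤ᵇ-≈ 1 ≤-refl (z≈ Y₂))))

OnlyPairᵇ-≈ : ∀ P {z z′} → z ≋[ 1 ] z′ → OnlyPairᵇ P z ≡ OnlyPairᵇ P z′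
OnlyPairᵇ-≈ P {z} {z′} z≈ = allᶠ-cong λ X → by-side X (inPair P X)
  where
  by-side : ∀ X b → (if b then 1 ≤ᵇ z X else z X ≤ᵇ 0) ≡ (if b then 1 ≤ᵇ z′ X else z′ X ≤ᵇ 0)
  by-side X true = ≥ᵇ-≈ 1 ≤-refl (z≈ X)
  by-side X false = ≤ᵇ-≈ 0 ≤-refl (z≈ X)

Decomposableᵇ-≈ : ∀ {z z′} → z ≋[ 2 ] z′ → Decomposableᵇ z ≡ Decomposableᵇ z′
Decomposableᵇ-≈ z≈ = cong₂ _∨_
  (cong₂ _∧_ (Occupiedᵇ-≈ (≋-weaken (s≤s z≤n) z≈)) (cong₂ _∨_
    (cong₂ _∧_ (≤ᵇ-≈ 1 ≤-refl (z≈ Y₁)) (≥ᵇ-≈ 2 ≤-refl (z≈ X₁)))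
    (cong₂ _∧_ (≤ᵇ-≈ 1 ≤-refl (z≈ X₂)) (≥ᵇ-≈ 2 ≤-refl (z≈ Y₂)))))
  (cong₂ _∨_ (OnlyPairᵇ-≈ X₁ (≋-weaken (s≤s z≤n) z≈)) (OnlyPairᵇ-≈ X₂ (≋-weaken (s≤s z≤n) z≈)))

FewPendentsᵇ-intro : ∀ {z} → (∀ P → 1 ≤ z P) → (2 ≤ z Y₁ ⊎ z X₁ ≤ 1) → (2 ≤ z X₂ ⊎ z Y₂ ≤ 1) →
  T (FewPendentsᵇ z)
FewPendentsᵇ-intro occupied left right = Equivalence.from T-∧
  (allᶠ-intro (≤⇒≤ᵇ ∘ occupied) , Equivalence.from T-∧ (either left , either right))
  where
  either : ∀ {a b c d} → a ≤ b ⊎ c ≤ d → T ((a ≤ᵇ b) ∨ (c ≤ᵇ d))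
  either (inj₁ a≤b) = Equivalence.from T-∨ (inj₁ (≤⇒≤ᵇ a≤b))
  either (inj₂ c≤d) = Equivalence.from T-∨ (inj₂ (≤⇒≤ᵇ c≤d))

Decomposableᵇ-intro : ∀ {z} → (∀ P → 1 ≤ z P) → (z Y₁ ≤ 1 × 2 ≤ z X₁) ⊎ (z X₂ ≤ 1 × 2 ≤ z Y₂) →
  T (Decomposableᵇ z)
Decomposableᵇ-intro occupied pendents = Equivalence.from T-∨ (inj₁ (Equivalence.from T-∧
  (allᶠ-intro (≤⇒≤ᵇ ∘ occupied) , both pendents)))
  where
  both : ∀ {a b c d e f g h} → (a ≤ b × c ≤ d) ⊎ (e ≤ f × g ≤ h) →
    T (((a ≤ᵇ b) ∧ (c ≤ᵇ d)) ∨ ((e ≤ᵇ f) ∧ (g ≤ᵇ h)))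
  both (inj₁ (p , q)) = Equivalence.from T-∨ (inj₁ (Equivalence.from T-∧ (≤⇒≤ᵇ p , ≤⇒≤ᵇ q)))
  both (inj₂ (p , q)) = Equivalence.from T-∨ (inj₂ (Equivalence.from T-∧ (≤⇒≤ᵇ p , ≤⇒≤ᵇ q)))

Decomposableᵇ-first : ∀ {a c} → 1 ≤ a → 1 ≤ c → T (Decomposableᵇ (profile a 0 c 0))
Decomposableᵇ-first (s≤s _) (s≤s _) = _

Decomposableᵇ-second : ∀ {b d} → 1 ≤ b → 1 ≤ d → T (Decomposableᵇ (profile 0 b 0 d))
Decomposableᵇ-second (s≤s _) (s≤s _) = _

min4 : ℕ → ℕ → ℕ
min4 x y = 4 ⊓ x ⊓ y

min4≤4 : ∀ x y → min4 x y ≤ 4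
min4≤4 x y = ≤-trans (m⊓n≤m (4 ⊓ x) y) (m⊓n≤m 4 x)

min4-≈ : ∀ {x y x′ y′} → x ≈[ 4 ] x′ → y ≈[ 4 ] y′ → min4 x y ≡ min4 x′ y′
min4-≈ {x′ = x′} x≈ y≈ = trans (cong (_⊓ _) (⊓-≈ ≤-refl x≈)) (⊓-≈ (m⊓n≤m 4 x′) y≈)

min4-≡ : ∀ {x y k} → k ≤ 4 → k ≤ x → k ≤ y → x ≡ k ⊎ y ≡ k → min4 x y ≡ k
min4-≡ {y = y} k≤4 _ k≤y (inj₁ refl) = trans (cong (_⊓ y) (m≥n⇒m⊓n≡n k≤4)) (m≤n⇒m⊓n≡m k≤y)
min4-≡ k≤4 k≤x _ (inj₂ refl) = m≥n⇒m⊓n≡n (⊓-glb k≤4 k≤x)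

min4-4 : ∀ {x y} → 4 ≤ x → 4 ≤ y → min4 x y ≡ 4
min4-4 {y = y} 4≤x 4≤y = trans (cong (_⊓ y) (m≤n⇒m⊓n≡m 4≤x)) (m≤n⇒m⊓n≡m 4≤y)

min4-3-or-4 : ∀ {x y} → 3 ≤ x → 3 ≤ y →
  ((x ≡ 3 ⊎ y ≡ 3) → min4 x y ≡ 3) × (x ≢ 3 → y ≢ 3 → min4 x y ≡ 4)
min4-3-or-4 3≤x 3≤y = min4-≡ (s≤s (s≤s (s≤s z≤n))) 3≤x 3≤y ,
  λ x≢3 y≢3 → min4-4 (≤∧≢⇒< 3≤x (≢-sym x≢3)) (≤∧≢⇒< 3≤y (≢-sym y≢3))

min4-2-3-or-4 : ∀ {x y} → 2 ≤ x → 2 ≤ y →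
  ((x ≡ 2 ⊎ y ≡ 2) → min4 x y ≡ 2) ×
  (x ≢ 2 → y ≢ 2 → ((x ≡ 3 ⊎ y ≡ 3) → min4 x y ≡ 3) × (x ≢ 3 → y ≢ 3 → min4 x y ≡ 4))
min4-2-3-or-4 2≤x 2≤y = min4-≡ (s≤s (s≤s z≤n)) 2≤x 2≤y ,
  λ x≢2 y≢2 → min4-3-or-4 (≤∧≢⇒< 2≤x (≢-sym x≢2)) (≤∧≢⇒< 2≤y (≢-sym y≢2))

γ-few : Profile 4 → ℕ
γ-few z = min4 (z X₁ + z X₂) (z Y₁ + z Y₂)

γ-few-≈ : ∀ {z z′} → z ≋[ 4 ] z′ → γ-few z ≡ γ-few z′
γ-few-≈ z≈ = min4-≈ (≈-+ (z≈ X₁) (z≈ X₂)) (≈-+ (z≈ Y₁) (z≈ Y₂))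

FewPendents-boundᵇ : Profile 4 → Profile 4 → Bool
FewPendents-boundᵇ s m = FewPendentsᵇ (s ⊕ m) ⇒ᵇ Cosecureᵇ s m ⇒ᵇ γ-few (s ⊕ m) ≤ᵇ sum s

FewPendents-smallᵇ : Profile 4 → Bool
FewPendents-smallᵇ s = (4 ≤ᵇ sum s) ∨ allProfilesᵇ (uniform 4) (FewPendents-boundᵇ s)

FewPendents-small : ∀ s → T (FewPendents-smallᵇ (capped (uniform 3) s))
FewPendents-small = allProfilesᵇ-sound (uniform 3) FewPendents-smallᵇ _

FewPendents-lower : ∀ s m → T (FewPendentsᵇ (s ⊕ m)) → T (Cosecureᵇ s m) → γ-few (s ⊕ m) ≤ sum s
FewPendents-lower s m few cos with 4 ≤? sum s
... | yes 4≤Σ = ≤-trans (min4≤4 _ _) 4≤Σ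
... | no Σ≱4 = subst₂ _≤_ (γ-few-≈ (≈-sym ∘ z≈)) Σ≡ (≤ᵇ⇒≤ _ _ verdict)
  where
  s′ : Profile 4
  s′ = capped (uniform 3) s
  m′ : Profile 4
  m′ = capped (uniform 4) m
  s′≡s : ∀ P → s′ P ≡ s P
  s′≡s P = capped-id (uniform 3) s P (≤-trans (≤-sum s P) (s≤s⁻¹ (≰⇒> Σ≱4)))
  Σ≡ : sum s′ ≡ sum s
  Σ≡ = sum-cong-≗ s′≡s
  s≈ : s ≋[ 4 ] s′
  s≈ P = inj₁ (sym (s′≡s P))
  m≈ : m ≋[ 4 ] m′
  m≈ = capped-≈ (uniform 4) m (λ _ → ≤-refl)
  z≈ : s ⊕ m ≋[ 4 ] s′ ⊕ m′
  z≈ = ⊕-≈ s≈ m≈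
  small : T (allProfilesᵇ (uniform 4) (FewPendents-boundᵇ s′))
  small = T-∨-resolve {4 ≤ᵇ sum s′} (FewPendents-small s)
            (λ h → Σ≱4 (subst (4 ≤_) Σ≡ (≤ᵇ⇒≤ 4 _ h)))
  verdict : T (γ-few (s′ ⊕ m′) ≤ᵇ sum s′)
  verdict = ⇒ᵇ-elim {Cosecureᵇ s′ m′} (⇒ᵇ-elim {FewPendentsᵇ (s′ ⊕ m′)}
              (allProfilesᵇ-sound (uniform 4) (FewPendents-boundᵇ s′) small m)
              (subst T (FewPendentsᵇ-≈ (≋-weaken (s≤s (s≤s z≤n)) z≈)) few))
              (subst T (Cosecureᵇ-≈ (≋-weaken (s≤s (s≤s z≤n)) s≈) (≋-weaken (s≤s (s≤s z≤n)) m≈)) cos)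

candidates : List (Profile 4)
candidates =
  profile 0 2 2 0 ∷ profile 1 2 0 0 ∷ profile 0 0 2 1 ∷ profile 0 2 1 1 ∷ profile 1 1 2 0 ∷
  profile 1 1 0 0 ∷ profile 0 0 1 1 ∷ profile 1 0 0 2 ∷ profile 1 1 1 0 ∷ []

Fitsᵇ : Profile 4 → Profile 4 → Bool
Fitsᵇ z s = allᶠ (λ P → (s P ≤ᵇ 2) ∧ (s P ≤ᵇ z P)) ∧ Cosecureᵇ s (z ⊖ s) ∧ (sum s ≡ᵇ γ-few z)

FewPendents-witnessᵇ : Profile 4 → Bool
FewPendents-witnessᵇ z = FewPendentsᵇ z ⇒ᵇ any (Fitsᵇ z) candidates

FewPendents-witness : ∀ z → T (FewPendents-witnessᵇ (capped (uniform 4) z))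
FewPendents-witness = allProfilesᵇ-sound (uniform 4) FewPendents-witnessᵇ _

Fitsᵇ⇒ : ∀ {z s} → T (Fitsᵇ z s) →
  (∀ P → s P ≤ 2) × (∀ P → s P ≤ z P) × T (Cosecureᵇ s (z ⊖ s)) × sum s ≡ γ-few z
Fitsᵇ⇒ {z} {s} fits with Equivalence.to (T-∧ {allᶠ λ P → (s P ≤ᵇ 2) ∧ (s P ≤ᵇ z P)}) fits
... | bounds , rest with Equivalence.to (T-∧ {Cosecureᵇ s (z ⊖ s)}) rest
...   | cos , Σ≡ = (λ P → ≤ᵇ⇒≤ _ 2 (proj₁ (bound P))) , (λ P → ≤ᵇ⇒≤ _ _ (proj₂ (bound P))) , cos , ≡ᵇ⇒≡ _ _ Σ≡
  where
  bound : ∀ P → T (s P ≤ᵇ 2) × T (s P ≤ᵇ z P)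
  bound P = Equivalence.to T-∧ (allᶠ-elim {f = λ P → (s P ≤ᵇ 2) ∧ (s P ≤ᵇ z P)} bounds P)

FewPendents-upper : ∀ z → T (FewPendentsᵇ z) →
  ∃[ s ] ∃[ m ] ((∀ P → s P + m P ≡ z P) × T (Cosecureᵇ s m) × sum s ≡ γ-few z)
FewPendents-upper z few = fitting (satisfied (any⁻ (Fitsᵇ z′) candidates
  (⇒ᵇ-elim {FewPendentsᵇ z′} (FewPendents-witness z)
    (subst T (FewPendentsᵇ-≈ (≋-weaken (s≤s (s≤s z≤n)) z≈)) few))))
  where
  z′ : Profile 4
  z′ = capped (uniform 4) z
  z≈ : z ≋[ 4 ] z′
  z≈ = capped-≈ (uniform 4) z (λ _ → ≤-refl)
  fitting : ∃[ c ] T (Fitsᵇ z′ c) →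
    ∃[ s ] ∃[ m ] ((∀ P → s P + m P ≡ z P) × T (Cosecureᵇ s m) × sum s ≡ γ-few z)
  fitting (c , fits) with Fitsᵇ⇒ fits
  ... | c≤2 , c≤z′ , cos , Σ≡ = c , z ⊖ c , (λ P → m+[n∸m]≡n (c≤z P)) ,
    subst T (Cosecureᵇ-≈ {s′ = c} (λ _ → ≈-refl)
      (λ P → ≈-∸ (c P) (≈-weaken (+-monoʳ-≤ 2 (c≤2 P)) (≈-sym (z≈ P))))) cos ,
    trans Σ≡ (γ-few-≈ (≈-sym ∘ z≈))
    where
    c≤z : ∀ P → c P ≤ z P
    c≤z P = ≤-trans (c≤z′ P) (capped-≤ (uniform 4) z P)

FewPendents-γ : ∀ z → T (FewPendentsᵇ z) → ProfileGammaCS z (γ-few z)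
FewPendents-γ z few = lower , FewPendents-upper z few
  where
  lower : ∀ s m → (∀ P → s P + m P ≡ z P) → T (Cosecureᵇ s m) → γ-few z ≤ sum s
  lower s m s+m cos = subst (_≤ sum s) (γ-few-≈ (inj₁ ∘ s+m))
    (FewPendents-lower s m (subst T (FewPendentsᵇ-≈ (inj₁ ∘ sym ∘ s+m)) few) cos)

-- γ_cs(K_{x,y}), and 0 when a side is empty.
γK : ℕ → ℕ → ℕ
γK 0 _ = 0
γK _ 0 = 0
γK 1 y = y
γK x 1 = x
γK x y = min4 x y

γ-split : Profile 4 → ℕ
γ-split z = γK (z X₁) (z Y₁) + γK (z X₂) (z Y₂)

γ-split-≗ : ∀ {z z′} → (∀ P → z P ≡ z′ P) → γ-split z ≡ γ-split z′
γ-split-≗ z≗ = cong₂ _+_ (cong₂ γK (z≗ X₁) (z≗ Y₁)) (cong₂ γK (z≗ X₂) (z≗ Y₂))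

γK-≤ : ∀ x y {b} → (x ≡ 1 → y ≤ b) → (y ≡ 1 → x ≤ b) → (2 ≤ x → 2 ≤ y → b ≤ 3 → min4 x y ≤ b) →
  γK x y ≤ b
γK-≤ 0 y _ _ _ = z≤n
γK-≤ (suc x) 0 _ _ _ = z≤n
γK-≤ 1 (suc y) x≡1 _ _ = x≡1 refl
γK-≤ (suc (suc x)) 1 _ y≡1 _ = y≡1 refl
γK-≤ (suc (suc x)) (suc (suc y)) {b} _ _ small with b ≤? 3
... | yes b≤3 = small (s≤s (s≤s z≤n)) (s≤s (s≤s z≤n)) b≤3
... | no b≰3 = ≤-trans (min4≤4 (suc (suc x)) (suc (suc y))) (≰⇒> b≰3)

-- When class P has a single vertex, m (partner P) ≤ s P; written with thresholds below 2 so that it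
-- survives capping the counts at 2.
LonePendentAtᵇ : Profile 4 → Profile 4 → Fin 4 → Bool
LonePendentAtᵇ s m P = ((1 ≤ᵇ s P + m P) ∧ (s P + m P ≤ᵇ 1)) ⇒ᵇ
  (m (partner P) ≤ᵇ 0) ∨ ((1 ≤ᵇ s P) ∧ (m (partner P) ≤ᵇ 1))

LonePendentᵇ : Profile 4 → Profile 4 → Bool
LonePendentᵇ s m = allᶠ (LonePendentAtᵇ s m)

LonePendentᵇ-≈ : ∀ {s m s′ m′} → s ≋[ 2 ] s′ → m ≋[ 2 ] m′ → LonePendentᵇ s m ≡ LonePendentᵇ s′ m′
LonePendentᵇ-≈ s≈ m≈ = allᶠ-cong λ P → cong₂ _⇒ᵇ_
  (cong₂ _∧_ (≥ᵇ-≈ 1 (s≤s z≤n) (⊕-≈ s≈ m≈ P)) (≤ᵇ-≈ 1 ≤-refl (⊕-≈ s≈ m≈ P)))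
  (cong₂ _∨_ (≤ᵇ-≈ 0 (s≤s z≤n) (m≈ (partner P)))
    (cong₂ _∧_ (≥ᵇ-≈ 1 (s≤s z≤n) (s≈ P)) (≤ᵇ-≈ 1 ≤-refl (m≈ (partner P)))))

LonePendent-boundᵇ : Profile 4 → Profile 4 → Bool
LonePendent-boundᵇ s m = Decomposableᵇ (s ⊕ m) ⇒ᵇ Cosecureᵇ s m ⇒ᵇ LonePendentᵇ s m

LonePendent-bound : ∀ s m → T (LonePendent-boundᵇ (capped (uniform 2) s) (capped (uniform 2) m))
LonePendent-bound s = allProfilesᵇ-sound (uniform 2) (LonePendent-boundᵇ (capped (uniform 2) s))
  (allProfilesᵇ-sound (uniform 2) (λ s → allProfilesᵇ (uniform 2) (LonePendent-boundᵇ s)) _ s)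

lonePendent : ∀ s m → T (Decomposableᵇ (s ⊕ m)) → T (Cosecureᵇ s m) → T (LonePendentᵇ s m)
lonePendent s m dec cos = subst T (sym (LonePendentᵇ-≈ s≈ m≈))
  (⇒ᵇ-elim {Cosecureᵇ s′ m′} (⇒ᵇ-elim {Decomposableᵇ (s′ ⊕ m′)} (LonePendent-bound s m)
    (subst T (Decomposableᵇ-≈ (⊕-≈ s≈ m≈)) dec))
    (subst T (Cosecureᵇ-≈ s≈ m≈) cos))
  where
  s′ : Profile 4
  s′ = capped (uniform 2) s
  m′ : Profile 4
  m′ = capped (uniform 2) m
  s≈ : s ≋[ 2 ] s′
  s≈ = capped-≈ (uniform 2) s (λ _ → ≤-refl)
  m≈ : m ≋[ 2 ] m′
  m≈ = capped-≈ (uniform 2) m (λ _ → ≤-refl)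

lone-pendent : ∀ s m → T (Decomposableᵇ (s ⊕ m)) → T (Cosecureᵇ s m) →
  ∀ P → s P + m P ≡ 1 → m (partner P) ≤ s P
lone-pendent s m dec cos P single =
  bound (Equivalence.to T-∨
    (⇒ᵇ-elim (allᶠ-elim {f = LonePendentAtᵇ s m} (lonePendent s m dec cos) P) is-single))
  where
  is-single : T ((1 ≤ᵇ s P + m P) ∧ (s P + m P ≤ᵇ 1))
  is-single = subst (λ x → T ((1 ≤ᵇ x) ∧ (x ≤ᵇ 1))) (sym single) _
  bound : T (m (partner P) ≤ᵇ 0) ⊎ T ((1 ≤ᵇ s P) ∧ (m (partner P) ≤ᵇ 1)) → m (partner P) ≤ s P
  bound (inj₁ none) = ≤-trans (≤ᵇ⇒≤ _ 0 none) z≤n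
  bound (inj₂ one) with Equivalence.to T-∧ one
  ... | 1≤s , m≤1 = ≤-trans (≤ᵇ⇒≤ _ 1 m≤1) (≤ᵇ⇒≤ 1 _ 1≤s)

pairBound : ℕ → Fin 4 → Profile 4
pairBound K P X = if inPair P X then K else 2

pairBound-≥2 : ∀ {K} → 2 ≤ K → ∀ P X → 2 ≤ pairBound K P X
pairBound-≥2 2≤K P X with inPair P X
... | true = 2≤K
... | false = ≤-refl

pairBound-in : ∀ {K} P X → inPair P X ≡ true → pairBound K P X ≡ K
pairBound-in P X inX rewrite inX = refl

inPair-self : ∀ P → inPair P P ≡ true
inPair-self X₁ = refl
inPair-self X₂ = refl
inPair-self Y₁ = refl
inPair-self Y₂ = refl

inPair-partner : ∀ P → inPair P (partner P) ≡ true
inPair-partner X₁ = refl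
inPair-partner X₂ = refl
inPair-partner Y₁ = refl
inPair-partner Y₂ = refl

Pair-boundᵇ : Fin 4 → Profile 4 → Profile 4 → Bool
Pair-boundᵇ P s m = Decomposableᵇ (s ⊕ m) ⇒ᵇ (2 ≤ᵇ s P + m P) ⇒ᵇ (2 ≤ᵇ s Q + m Q) ⇒ᵇ Cosecureᵇ s m ⇒ᵇ
  min4 (s P + m P) (s Q + m Q) ≤ᵇ s P + s Q
  where
  Q : Fin 4
  Q = partner P

Pair-smallᵇ : Fin 4 → Profile 4 → Bool
Pair-smallᵇ P s = (4 ≤ᵇ s P + s (partner P)) ∨ allProfilesᵇ (pairBound 4 P) (Pair-boundᵇ P s)

PairSmall : Fin 4 → Set
PairSmall P = ∀ s → T (Pair-smallᵇ P (capped (pairBound 3 P) s))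

pair-small-X₁ : PairSmall X₁
pair-small-X₁ = allProfilesᵇ-sound (pairBound 3 X₁) (Pair-smallᵇ X₁) _

pair-small-X₂ : PairSmall X₂
pair-small-X₂ = allProfilesᵇ-sound (pairBound 3 X₂) (Pair-smallᵇ X₂) _

pair-min4 : ∀ P → PairSmall P →
  ∀ s m → T (Decomposableᵇ (s ⊕ m)) → T (Cosecureᵇ s m) →
  2 ≤ s P + m P → 2 ≤ s (partner P) + m (partner P) → s P + s (partner P) ≤ 3 →
  min4 (s P + m P) (s (partner P) + m (partner P)) ≤ s P + s (partner P)
pair-min4 P table s m dec cos 2≤x 2≤y small = subst₂ _≤_ (sym min4≡) sum≡ (≤ᵇ⇒≤ _ _ verdict)
  where
  Q : Fin 4
  Q = partner P
  s′ : Profile 4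
  s′ = capped (pairBound 3 P) s
  m′ : Profile 4
  m′ = capped (pairBound 4 P) m
  s≈ : s ≋[ 2 ] s′
  s≈ = capped-≈ (pairBound 3 P) s (pairBound-≥2 (s≤s (s≤s z≤n)) P)
  m≈ : m ≋[ 2 ] m′
  m≈ = capped-≈ (pairBound 4 P) m (pairBound-≥2 (s≤s (s≤s z≤n)) P)
  exact : ∀ X → inPair P X ≡ true → s X ≤ 3 → s′ X ≡ s X
  exact X inX s≤3 = capped-id (pairBound 3 P) s X (subst (s X ≤_) (sym (pairBound-in P X inX)) s≤3)
  on-pair : ∀ X → inPair P X ≡ true → s X ≤ 3 → s X + m X ≈[ 4 ] s′ X + m′ X
  on-pair X inX s≤3 = ≈-+ (inj₁ (sym (exact X inX s≤3)))
    (subst (m X ≈[ 4 ]_) (sym (trans (capped-spec (pairBound 4 P) m X) (cong (_⊓ m X) (pairBound-in P X inX))))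
           (≈-⊓ 4 (m X)))
  sP≤3 : s P ≤ 3
  sP≤3 = ≤-trans (m≤m+n (s P) (s Q)) small
  sQ≤3 : s Q ≤ 3
  sQ≤3 = ≤-trans (m≤n+m (s Q) (s P)) small
  x≈ : s P + m P ≈[ 4 ] s′ P + m′ P
  x≈ = on-pair P (inPair-self P) sP≤3
  y≈ : s Q + m Q ≈[ 4 ] s′ Q + m′ Q
  y≈ = on-pair Q (inPair-partner P) sQ≤3
  sum≡ : s′ P + s′ Q ≡ s P + s Q
  sum≡ = cong₂ _+_ (exact P (inPair-self P) sP≤3) (exact Q (inPair-partner P) sQ≤3)
  min4≡ : min4 (s P + m P) (s Q + m Q) ≡ min4 (s′ P + m′ P) (s′ Q + m′ Q)
  min4≡ = min4-≈ x≈ y≈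
  pair-small : T (allProfilesᵇ (pairBound 4 P) (Pair-boundᵇ P s′))
  pair-small = T-∨-resolve {4 ≤ᵇ s′ P + s′ Q} (table s)
    (λ h → <⇒≱ (s≤s small) (subst (4 ≤_) sum≡ (≤ᵇ⇒≤ 4 _ h)))
  verdict : T (min4 (s′ P + m′ P) (s′ Q + m′ Q) ≤ᵇ s′ P + s′ Q)
  verdict = ⇒ᵇ-elim {Cosecureᵇ s′ m′} (⇒ᵇ-elim {2 ≤ᵇ s′ Q + m′ Q} (⇒ᵇ-elim {2 ≤ᵇ s′ P + m′ P}
    (⇒ᵇ-elim {Decomposableᵇ (s′ ⊕ m′)} (allProfilesᵇ-sound (pairBound 4 P) (Pair-boundᵇ P s′) pair-small m)
    (subst T (Decomposableᵇ-≈ (⊕-≈ s≈ m≈)) dec))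
    (subst T (≥ᵇ-≈ 2 (s≤s (s≤s z≤n)) x≈) (≤⇒≤ᵇ 2≤x)))
    (subst T (≥ᵇ-≈ 2 (s≤s (s≤s z≤n)) y≈) (≤⇒≤ᵇ 2≤y)))
    (subst T (Cosecureᵇ-≈ s≈ m≈) cos)

pair-γK : ∀ P → PairSmall P →
  ∀ s m → T (Decomposableᵇ (s ⊕ m)) → T (Cosecureᵇ s m) →
  γK (s P + m P) (s (partner P) + m (partner P)) ≤ s P + s (partner P)
pair-γK P table s m dec cos = γK-≤ _ _ lone-P lone-Q (pair-min4 P table s m dec cos)
  where
  Q : Fin 4
  Q = partner P
  lone-P : s P + m P ≡ 1 → s Q + m Q ≤ s P + s Q
  lone-P single =
    ≤-trans (+-monoʳ-≤ (s Q) (lone-pendent s m dec cos P single)) (≤-reflexive (+-comm (s Q) (s P)))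
  lone-Q : s Q + m Q ≡ 1 → s P + m P ≤ s P + s Q
  lone-Q single =
    +-monoʳ-≤ (s P) (subst (λ X → m X ≤ s Q) (partner-involutive P) (lone-pendent s m dec cos Q single))

Decomposable-lower : ∀ s m → T (Decomposableᵇ (s ⊕ m)) → T (Cosecureᵇ s m) → γ-split (s ⊕ m) ≤ sum s
Decomposable-lower s m dec cos =
  subst (γ-split (s ⊕ m) ≤_) (sym (sum-profile (s X₁) (s X₂) (s Y₁) (s Y₂)))
    (+-mono-≤ (pair-γK X₁ pair-small-X₁ s m dec cos) (pair-γK X₂ pair-small-X₂ s m dec cos))

data Portion : Set where
  takeNone takeAll takeTwo : Portion

portion : Portion → ℕ → ℕ
portion takeNone _ = 0
portion takeAll x = x
portion takeTwo _ = 2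

-- How a minimum cosecure dominating set of K_{x,y} meets the two sides.
bicliqueSplit : ℕ → ℕ → Portion × Portion
bicliqueSplit 0 _ = takeNone , takeNone
bicliqueSplit _ 0 = takeNone , takeNone
bicliqueSplit 1 _ = takeNone , takeAll
bicliqueSplit _ 1 = takeAll , takeNone
bicliqueSplit 2 _ = takeAll , takeNone
bicliqueSplit _ 2 = takeNone , takeAll
bicliqueSplit 3 _ = takeAll , takeNone
bicliqueSplit _ 3 = takeNone , takeAll
bicliqueSplit _ _ = takeTwo , takeTwo

bicliqueSplit-cap : ∀ x y → bicliqueSplit x y ≡ bicliqueSplit (4 ⊓ x) (4 ⊓ y)
bicliqueSplit-cap 0 y = refl
bicliqueSplit-cap (suc x) 0 = refl
bicliqueSplit-cap 1 (suc y) = refl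
bicliqueSplit-cap (suc (suc x)) 1 = refl
bicliqueSplit-cap 2 (suc (suc y)) = refl
bicliqueSplit-cap (suc (suc (suc x))) 2 = refl
bicliqueSplit-cap 3 (suc (suc (suc y))) = refl
bicliqueSplit-cap (suc (suc (suc (suc x)))) 3 = refl
bicliqueSplit-cap (suc (suc (suc (suc x)))) (suc (suc (suc (suc y)))) = refl

bicliqueSplit-≤ : ∀ x y → portion (proj₁ (bicliqueSplit x y)) x ≤ x × portion (proj₂ (bicliqueSplit x y)) y ≤ y
bicliqueSplit-≤ 0 y = z≤n , z≤n
bicliqueSplit-≤ (suc x) 0 = z≤n , z≤n
bicliqueSplit-≤ 1 (suc y) = z≤n , ≤-refl
bicliqueSplit-≤ (suc (suc x)) 1 = ≤-refl , z≤n
bicliqueSplit-≤ 2 (suc (suc y)) = ≤-refl , z≤n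
bicliqueSplit-≤ (suc (suc (suc x))) 2 = z≤n , ≤-refl
bicliqueSplit-≤ 3 (suc (suc (suc y))) = ≤-refl , z≤n
bicliqueSplit-≤ (suc (suc (suc (suc x)))) 3 = z≤n , ≤-refl
bicliqueSplit-≤ (suc (suc (suc (suc x)))) (suc (suc (suc (suc y)))) = s≤s (s≤s z≤n) , s≤s (s≤s z≤n)

bicliqueSplit-sum : ∀ x y →
  portion (proj₁ (bicliqueSplit x y)) x + portion (proj₂ (bicliqueSplit x y)) y ≡ γK x y
bicliqueSplit-sum 0 y = refl
bicliqueSplit-sum (suc x) 0 = refl
bicliqueSplit-sum 1 (suc y) = refl
bicliqueSplit-sum (suc (suc x)) 1 = +-identityʳ _
bicliqueSplit-sum 2 (suc (suc y)) = refl
bicliqueSplit-sum (suc (suc (suc x))) 2 = refl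
bicliqueSplit-sum 3 (suc (suc (suc y))) = refl
bicliqueSplit-sum (suc (suc (suc (suc x)))) 3 = refl
bicliqueSplit-sum (suc (suc (suc (suc x)))) (suc (suc (suc (suc y)))) = refl

portion-≈ : ∀ c x → portion c x ≈[ 2 ] portion c (4 ⊓ x) × x ∸ portion c x ≈[ 2 ] 4 ⊓ x ∸ portion c (4 ⊓ x)
portion-≈ takeNone x = ≈-refl , ≈-weaken (s≤s (s≤s z≤n)) (≈-⊓ 4 x)
portion-≈ takeAll x = ≈-weaken (s≤s (s≤s z≤n)) (≈-⊓ 4 x) , inj₁ (trans (n∸n≡0 x) (sym (n∸n≡0 (4 ⊓ x))))
portion-≈ takeTwo x = ≈-refl , ≈-∸ 2 (≈-⊓ 4 x)

selectPortions : Portion × Portion → Portion × Portion → Profile 4 → Profile 4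
selectPortions (a , b) (c , d) z =
  profile (portion a (z X₁)) (portion c (z X₂)) (portion b (z Y₁)) (portion d (z Y₂))

splitWitness : Profile 4 → Profile 4
splitWitness z = selectPortions (bicliqueSplit (z X₁) (z Y₁)) (bicliqueSplit (z X₂) (z Y₂)) z

selectPortions-≈ : ∀ p q z → let z′ = capped (uniform 4) z in
  selectPortions p q z ≋[ 2 ] selectPortions p q z′ × z ⊖ selectPortions p q z ≋[ 2 ] z′ ⊖ selectPortions p q z′
selectPortions-≈ (a , b) (c , d) z = selected≈ , unselected≈
  where
  selected≈ : selectPortions (a , b) (c , d) z ≋[ 2 ] selectPortions (a , b) (c , d) (capped (uniform 4) z)
  selected≈ X₁ = proj₁ (portion-≈ a (z X₁))
  selected≈ X₂ = proj₁ (portion-≈ c (z X₂))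
  selected≈ Y₁ = proj₁ (portion-≈ b (z Y₁))
  selected≈ Y₂ = proj₁ (portion-≈ d (z Y₂))
  unselected≈ : z ⊖ selectPortions (a , b) (c , d) z ≋[ 2 ]
    capped (uniform 4) z ⊖ selectPortions (a , b) (c , d) (capped (uniform 4) z)
  unselected≈ X₁ = proj₂ (portion-≈ a (z X₁))
  unselected≈ X₂ = proj₂ (portion-≈ c (z X₂))
  unselected≈ Y₁ = proj₂ (portion-≈ b (z Y₁))
  unselected≈ Y₂ = proj₂ (portion-≈ d (z Y₂))

splitWitness-≤ : ∀ z P → splitWitness z P ≤ z P
splitWitness-≤ z X₁ = proj₁ (bicliqueSplit-≤ (z X₁) (z Y₁))
splitWitness-≤ z X₂ = proj₁ (bicliqueSplit-≤ (z X₂) (z Y₂))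
splitWitness-≤ z Y₁ = proj₂ (bicliqueSplit-≤ (z X₁) (z Y₁))
splitWitness-≤ z Y₂ = proj₂ (bicliqueSplit-≤ (z X₂) (z Y₂))

Decomposable-witnessᵇ : Profile 4 → Bool
Decomposable-witnessᵇ z = Decomposableᵇ z ⇒ᵇ Cosecureᵇ (splitWitness z) (z ⊖ splitWitness z)

Decomposable-witness : ∀ z → T (Decomposable-witnessᵇ (capped (uniform 4) z))
Decomposable-witness = allProfilesᵇ-sound (uniform 4) Decomposable-witnessᵇ _

Decomposable-upper : ∀ z → T (Decomposableᵇ z) →
  ∃[ s ] ∃[ m ] ((∀ P → s P + m P ≡ z P) × T (Cosecureᵇ s m) × sum s ≡ γ-split z)
Decomposable-upper z dec = W , z ⊖ W , (λ P → m+[n∸m]≡n (splitWitness-≤ z P)) , cos , Σ≡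
  where
  W : Profile 4
  W = splitWitness z
  z′ : Profile 4
  z′ = capped (uniform 4) z
  p : Portion × Portion
  p = bicliqueSplit (z X₁) (z Y₁)
  q : Portion × Portion
  q = bicliqueSplit (z X₂) (z Y₂)
  same-split : splitWitness z′ ≡ selectPortions p q z′
  same-split = cong₂ (λ p q → selectPortions p q z′)
    (sym (bicliqueSplit-cap (z X₁) (z Y₁))) (sym (bicliqueSplit-cap (z X₂) (z Y₂)))
  capped-cos : T (Cosecureᵇ (selectPortions p q z′) (z′ ⊖ selectPortions p q z′))
  capped-cos = subst (λ w → T (Cosecureᵇ w (z′ ⊖ w))) same-split
    (⇒ᵇ-elim {Decomposableᵇ z′} (Decomposable-witness z)
      (subst T (Decomposableᵇ-≈ (capped-≈ (uniform 4) z (λ _ → s≤s (s≤s z≤n)))) dec))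
  cos : T (Cosecureᵇ W (z ⊖ W))
  cos = subst T (sym (Cosecureᵇ-≈ (proj₁ (selectPortions-≈ p q z)) (proj₂ (selectPortions-≈ p q z)))) capped-cos
  Σ≡ : sum W ≡ γ-split z
  Σ≡ = trans (sum-profile (W X₁) (W X₂) (W Y₁) (W Y₂))
    (cong₂ _+_ (bicliqueSplit-sum (z X₁) (z Y₁)) (bicliqueSplit-sum (z X₂) (z Y₂)))

Decomposable-γ : ∀ z → T (Decomposableᵇ z) → ProfileGammaCS z (γ-split z)
Decomposable-γ z dec = lower , Decomposable-upper z dec
  where
  lower : ∀ s m → (∀ P → s P + m P ≡ z P) → T (Cosecureᵇ s m) → γ-split z ≤ sum s
  lower s m s+m cos = subst (_≤ sum s) (γ-split-≗ s+m)
    (Decomposable-lower s m (subst T (Decomposableᵇ-≈ (inj₁ ∘ sym ∘ s+m)) dec) cos)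

module TwoClassChainGraph {n : ℕ} (G : Graph n) (X : Subset n) (x₁ x₂ : Fin n)
  (noIsolated : NoIsolated G) (chain : ChainGraph G X) (classes : TwoClasses G X x₁ x₂) where

  bipartite : Bipartition G X
  bipartite = proj₁ chain

  x₁∈X : x₁ ∈ X
  x₁∈X = proj₁ classes

  x₂∈X : x₂ ∈ X
  x₂∈X = proj₁ (proj₂ classes)

  N₁⊂N₂ : N G x₁ ⊂ N G x₂
  N₁⊂N₂ = proj₁ (proj₂ (proj₂ classes))

  neighbourhoods : ∀ x → x ∈ X → N G x ≡ N G x₁ ⊎ N G x ≡ N G x₂
  neighbourhoods = proj₂ (proj₂ (proj₂ classes))

  ∈N⇒edge : ∀ {u v} → v ∈ N G u → Edge G u v
  ∈N⇒edge {u} {v} v∈Nu = trans (sym (lookup∘tabulate (adj G u) v)) ([]=⇒lookup v∈Nu)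

  edge⇒∈N : ∀ {u v} → Edge G u v → v ∈ N G u
  edge⇒∈N {u} {v} uv = lookup⇒∈ (trans (lookup∘tabulate (adj G u) v) uv)

  adj-via : ∀ {u w} → N G u ≡ N G w → ∀ v → adj G u v ≡ adj G w v
  adj-via {u} {w} Nu≡Nw v = trans (sym (lookup∘tabulate (adj G u) v))
    (trans (cong (λ p → lookup p v) Nu≡Nw) (lookup∘tabulate (adj G w) v))

  no-edge-in-X : ∀ {u v} → u ∈ X → v ∈ X → adj G u v ≡ false
  no-edge-in-X {u} {v} u∈X v∈X with adj G u v in uv
  ... | false = refl
  ... | true = ⊥-elim (proj₁ (bipartite u v uv) u∈X v∈X)

  no-edge-in-Y : ∀ {u v} → u ∉ X → v ∉ X → adj G u v ≡ false
  no-edge-in-Y {u} {v} u∉X v∉X with adj G u v in uv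
  ... | false = refl
  ... | true = ⊥-elim (v∉X (proj₂ (bipartite u v uv) u∉X))

  N₂≢N₁ : N G x₂ ≢ N G x₁
  N₂≢N₁ N₂≡N₁ with proj₂ N₁⊂N₂
  ... | y , y∈N₂ , y∉N₁ = y∉N₁ (subst (y ∈_) N₂≡N₁ y∈N₂)

  N⊆N₂ : ∀ {w} → w ∈ X → N G w ⊆ N G x₂
  N⊆N₂ {w} w∈X {v} v∈Nw with neighbourhoods w w∈X
  ... | inj₁ Nw≡N₁ = proj₁ N₁⊂N₂ (subst (v ∈_) Nw≡N₁ v∈Nw)
  ... | inj₂ Nw≡N₂ = subst (v ∈_) Nw≡N₂ v∈Nw

  x₂-sees-Y : ∀ {v} → v ∉ X → Edge G x₂ v
  x₂-sees-Y {v} v∉X with noIsolated v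
  ... | w , vw = ∈N⇒edge (N⊆N₂ (proj₂ (bipartite v w vw) v∉X) (edge⇒∈N (trans (Graph.sym G w v) vw)))

  classBy : Bool → Bool → Bool → Fin 4
  classBy true true _ = X₁
  classBy true false _ = X₂
  classBy false _ true = Y₁
  classBy false _ false = Y₂

  sameNeighbourhood : Fin n → Fin n → Bool
  sameNeighbourhood i j = does (≡-dec Bool._≟_ (N G i) (N G j))

  classOf : Fin n → Fin 4
  classOf i = classBy (lookup X i) (sameNeighbourhood i x₁) (adj G x₁ i)

  data Position (i : Fin n) : Fin 4 → Set where
    at-X₁ : i ∈ X → N G i ≡ N G x₁ → Position i X₁
    at-X₂ : i ∈ X → N G i ≡ N G x₂ → Position i X₂
    at-Y₁ : i ∉ X → Edge G x₁ i → Position i Y₁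
    at-Y₂ : i ∉ X → adj G x₁ i ≡ false → Position i Y₂

  position : ∀ i → Position i (classOf i)
  position i = classify (lookup X i) (≡-dec Bool._≟_ (N G i) (N G x₁)) (adj G x₁ i) refl refl
    where
    classify : ∀ a (d : Dec (N G i ≡ N G x₁)) c → lookup X i ≡ a → adj G x₁ i ≡ c →
      Position i (classBy a (does d) c)
    classify true (yes same) _ Xᵢ _ = at-X₁ (lookup⇒∈ Xᵢ) same
    classify true (no differ) _ Xᵢ _ with neighbourhoods i (lookup⇒∈ Xᵢ)
    ... | inj₁ same = ⊥-elim (differ same)
    ... | inj₂ Nᵢ≡N₂ = at-X₂ (lookup⇒∈ Xᵢ) Nᵢ≡N₂
    classify false _ true Xᵢ e = at-Y₁ (lookup⇒∉ Xᵢ) e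
    classify false _ false Xᵢ e = at-Y₂ (lookup⇒∉ Xᵢ) e

  position-unique : ∀ {i P Q} → Position i P → Position i Q → P ≡ Q
  position-unique (at-X₁ _ _) (at-X₁ _ _) = refl
  position-unique (at-X₁ _ N₁) (at-X₂ _ N₂) = ⊥-elim (N₂≢N₁ (trans (sym N₂) N₁))
  position-unique (at-X₁ i∈X _) (at-Y₁ i∉X _) = ⊥-elim (i∉X i∈X)
  position-unique (at-X₁ i∈X _) (at-Y₂ i∉X _) = ⊥-elim (i∉X i∈X)
  position-unique (at-X₂ _ N₂) (at-X₁ _ N₁) = ⊥-elim (N₂≢N₁ (trans (sym N₂) N₁))
  position-unique (at-X₂ _ _) (at-X₂ _ _) = refl
  position-unique (at-X₂ i∈X _) (at-Y₁ i∉X _) = ⊥-elim (i∉X i∈X)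
  position-unique (at-X₂ i∈X _) (at-Y₂ i∉X _) = ⊥-elim (i∉X i∈X)
  position-unique (at-Y₁ i∉X _) (at-X₁ i∈X _) = ⊥-elim (i∉X i∈X)
  position-unique (at-Y₁ i∉X _) (at-X₂ i∈X _) = ⊥-elim (i∉X i∈X)
  position-unique (at-Y₁ _ _) (at-Y₁ _ _) = refl
  position-unique (at-Y₁ _ e) (at-Y₂ _ e′) with trans (sym e) e′
  ... | ()
  position-unique (at-Y₂ i∉X _) (at-X₁ i∈X _) = ⊥-elim (i∉X i∈X)
  position-unique (at-Y₂ i∉X _) (at-X₂ i∈X _) = ⊥-elim (i∉X i∈X)
  position-unique (at-Y₂ _ e′) (at-Y₁ _ e) with trans (sym e) e′
  ... | ()
  position-unique (at-Y₂ _ _) (at-Y₂ _ _) = refl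

  classOf≡ : ∀ {i P} → Position i P → classOf i ≡ P
  classOf≡ {i} = position-unique (position i)

  adj-X-Y : ∀ {u v P Q} → Position u P → Position v Q → u ∈ X → v ∉ X → adj G u v ≡ P₄ P Q
  adj-X-Y (at-X₁ _ Nu) (at-Y₁ _ e) _ _ = trans (adj-via Nu _) e
  adj-X-Y (at-X₁ _ Nu) (at-Y₂ _ e) _ _ = trans (adj-via Nu _) e
  adj-X-Y (at-X₂ _ Nu) (at-Y₁ v∉X _) _ _ = trans (adj-via Nu _) (x₂-sees-Y v∉X)
  adj-X-Y (at-X₂ _ Nu) (at-Y₂ v∉X _) _ _ = trans (adj-via Nu _) (x₂-sees-Y v∉X)
  adj-X-Y (at-Y₁ u∉X _) _ u∈X _ = ⊥-elim (u∉X u∈X)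
  adj-X-Y (at-Y₂ u∉X _) _ u∈X _ = ⊥-elim (u∉X u∈X)
  adj-X-Y _ (at-X₁ v∈X _) _ v∉X = ⊥-elim (v∉X v∈X)
  adj-X-Y _ (at-X₂ v∈X _) _ v∉X = ⊥-elim (v∉X v∈X)

  adj-position : ∀ {u v P Q} → Position u P → Position v Q → adj G u v ≡ P₄ P Q
  adj-position (at-X₁ u∈X _) (at-X₁ v∈X _) = no-edge-in-X u∈X v∈X
  adj-position (at-X₁ u∈X _) (at-X₂ v∈X _) = no-edge-in-X u∈X v∈X
  adj-position (at-X₂ u∈X _) (at-X₁ v∈X _) = no-edge-in-X u∈X v∈X
  adj-position (at-X₂ u∈X _) (at-X₂ v∈X _) = no-edge-in-X u∈X v∈X
  adj-position (at-Y₁ u∉X _) (at-Y₁ v∉X _) = no-edge-in-Y u∉X v∉X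
  adj-position (at-Y₁ u∉X _) (at-Y₂ v∉X _) = no-edge-in-Y u∉X v∉X
  adj-position (at-Y₂ u∉X _) (at-Y₁ v∉X _) = no-edge-in-Y u∉X v∉X
  adj-position (at-Y₂ u∉X _) (at-Y₂ v∉X _) = no-edge-in-Y u∉X v∉X
  adj-position pu@(at-X₁ u∈X _) pv@(at-Y₁ v∉X _) = adj-X-Y pu pv u∈X v∉X
  adj-position pu@(at-X₁ u∈X _) pv@(at-Y₂ v∉X _) = adj-X-Y pu pv u∈X v∉X
  adj-position pu@(at-X₂ u∈X _) pv@(at-Y₁ v∉X _) = adj-X-Y pu pv u∈X v∉X
  adj-position pu@(at-X₂ u∈X _) pv@(at-Y₂ v∉X _) = adj-X-Y pu pv u∈X v∉X
  adj-position {u} {v} pu@(at-Y₁ u∉X _) pv@(at-X₁ v∈X _) = trans (Graph.sym G u v) (adj-X-Y pv pu v∈X u∉X)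
  adj-position {u} {v} pu@(at-Y₁ u∉X _) pv@(at-X₂ v∈X _) = trans (Graph.sym G u v) (adj-X-Y pv pu v∈X u∉X)
  adj-position {u} {v} pu@(at-Y₂ u∉X _) pv@(at-X₁ v∈X _) = trans (Graph.sym G u v) (adj-X-Y pv pu v∈X u∉X)
  adj-position {u} {v} pu@(at-Y₂ u∉X _) pv@(at-X₂ v∈X _) = trans (Graph.sym G u v) (adj-X-Y pv pu v∈X u∉X)

  adjacency : ∀ u v → adj G u v ≡ P₄ (classOf u) (classOf v)
  adjacency u v = adj-position (position u) (position v)

  module Restricted (Z : Subset n) = BlowUp G Z P₄ classOf (λ {u} {v} _ _ → adjacency u v)
  open Restricted (All G) public using (classSize; GammaCSIn-fromProfile)

  z : Profile 4
  z = classSize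

  inClass-All : ∀ P i → Restricted.inClass (All G) P i ≡ (classOf i ≡ᶠ P)
  inClass-All P i = cong (_∧ (classOf i ≡ᶠ P)) (lookup∘tabulate (λ _ → true) i)

  count-classOf : ∀ P → count (λ i → classOf i ≡ᶠ P) ≡ z P
  count-classOf P = count-cong (sym ∘ inClass-All P)

  in-class : ∀ {i P} → Position i P → (classOf i ≡ᶠ P) ≡ true
  in-class {P = P} p = trans (cong (_≡ᶠ P) (classOf≡ p)) (≡ᶠ-refl P)

  member : ∀ {i P} → Position i P → 1 ≤ z P
  member {i} {P} p = subst (1 ≤_) (count-classOf P) (count-member i (in-class p))

  two-members : ∀ {u v P} → Position u P → Position v P → u ≢ v → 2 ≤ z P
  two-members {P = P} pu pv u≢v = subst (2 ≤_) (count-classOf P) (count-two u≢v (in-class pu) (in-class pv))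

  two-members⁻ : ∀ {P} → 2 ≤ z P → ∃[ u ] ∃[ v ] (u ≢ v × Position u P × Position v P)
  two-members⁻ {P} 2≤z with count-two-witness (subst (2 ≤_) (sym (count-classOf P)) 2≤z)
  ... | u , v , u≢v , uP , vP =
    u , v , u≢v , subst (Position u) (≡ᶠ-true uP) (position u) , subst (Position v) (≡ᶠ-true vP) (position v)

  y₁-witness : ∃[ y ] Position y Y₁
  y₁-witness with noIsolated x₁
  ... | y , x₁y = y , at-Y₁ (proj₁ (bipartite x₁ y x₁y) x₁∈X) x₁y

  y₂-witness : ∃[ y ] Position y Y₂
  y₂-witness with proj₂ N₁⊂N₂
  ... | y , y∈N₂ , y∉N₁ = y , at-Y₂ (proj₁ (bipartite x₂ y (∈N⇒edge y∈N₂)) x₂∈X)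
    (trans (sym (lookup∘tabulate (adj G x₁) y)) (∉⇒lookup y∉N₁))

  occupied : ∀ P → 1 ≤ z P
  occupied X₁ = member (at-X₁ x₁∈X refl)
  occupied X₂ = member (at-X₂ x₂∈X refl)
  occupied Y₁ = member (proj₂ y₁-witness)
  occupied Y₂ = member (proj₂ y₂-witness)

  ∣X∣≡ : ∣ X ∣ ≡ z X₁ + z X₂
  ∣X∣≡ = trans (∣∣≡count X) (trans (count-split by-position) (cong₂ _+_ (count-classOf X₁) (count-classOf X₂)))
    where
    by-position : ∀ i → ⟦ lookup X i ⟧ ≡ ⟦ classOf i ≡ᶠ X₁ ⟧ + ⟦ classOf i ≡ᶠ X₂ ⟧
    by-position i with classOf i | position i
    ... | _ | at-X₁ i∈X _ rewrite []=⇒lookup i∈X = refl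
    ... | _ | at-X₂ i∈X _ rewrite []=⇒lookup i∈X = refl
    ... | _ | at-Y₁ i∉X _ rewrite ∉⇒lookup i∉X = refl
    ... | _ | at-Y₂ i∉X _ rewrite ∉⇒lookup i∉X = refl

  ∣Y∣≡ : ∣ ∁ X ∣ ≡ z Y₁ + z Y₂
  ∣Y∣≡ = trans (∣∣≡count (∁ X))
    (trans (count-split by-position) (cong₂ _+_ (count-classOf Y₁) (count-classOf Y₂)))
    where
    by-position : ∀ i → ⟦ lookup (∁ X) i ⟧ ≡ ⟦ classOf i ≡ᶠ Y₁ ⟧ + ⟦ classOf i ≡ᶠ Y₂ ⟧
    by-position i rewrite lookup-map i not X with classOf i | position i
    ... | _ | at-X₁ i∈X _ rewrite []=⇒lookup i∈X = refl
    ... | _ | at-X₂ i∈X _ rewrite []=⇒lookup i∈X = refl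
    ... | _ | at-Y₁ i∉X _ rewrite ∉⇒lookup i∉X = refl
    ... | _ | at-Y₂ i∉X _ rewrite ∉⇒lookup i∉X = refl

  deg-classOf : ∀ v → deg G v ≡ count (λ w → P₄ (classOf v) (classOf w))
  deg-classOf v = trans (∣∣≡count (N G v)) (count-cong λ w → trans (lookup∘tabulate (adj G v) w) (adjacency v w))

  count-neighbours : ∀ P {A B} → (∀ Q → ⟦ P₄ P Q ⟧ ≡ ⟦ Q ≡ᶠ A ⟧ + ⟦ Q ≡ᶠ B ⟧) →
    count (λ w → P₄ P (classOf w)) ≡ z A + z B
  count-neighbours P {A} {B} split =
    trans (count-split (split ∘ classOf)) (cong₂ _+_ (count-classOf A) (count-classOf B))

  deg-X₁ : ∀ {v} → Position v X₁ → deg G v ≡ z Y₁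
  deg-X₁ {v} p rewrite deg-classOf v | classOf≡ p = trans (count-cong (only-Y₁ ∘ classOf)) (count-classOf Y₁)
    where
    only-Y₁ : ∀ Q → P₄ X₁ Q ≡ (Q ≡ᶠ Y₁)
    only-Y₁ X₁ = refl
    only-Y₁ X₂ = refl
    only-Y₁ Y₁ = refl
    only-Y₁ Y₂ = refl

  deg-X₂ : ∀ {v} → Position v X₂ → deg G v ≡ z Y₁ + z Y₂
  deg-X₂ {v} p rewrite deg-classOf v | classOf≡ p = count-neighbours X₂ split
    where
    split : ∀ Q → ⟦ P₄ X₂ Q ⟧ ≡ ⟦ Q ≡ᶠ Y₁ ⟧ + ⟦ Q ≡ᶠ Y₂ ⟧
    split X₁ = refl
    split X₂ = refl
    split Y₁ = refl
    split Y₂ = refl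

  deg-Y₁ : ∀ {v} → Position v Y₁ → deg G v ≡ z X₁ + z X₂
  deg-Y₁ {v} p rewrite deg-classOf v | classOf≡ p = count-neighbours Y₁ split
    where
    split : ∀ Q → ⟦ P₄ Y₁ Q ⟧ ≡ ⟦ Q ≡ᶠ X₁ ⟧ + ⟦ Q ≡ᶠ X₂ ⟧
    split X₁ = refl
    split X₂ = refl
    split Y₁ = refl
    split Y₂ = refl

  deg-Y₂ : ∀ {v} → Position v Y₂ → deg G v ≡ z X₂
  deg-Y₂ {v} p rewrite deg-classOf v | classOf≡ p = trans (count-cong (only-X₂ ∘ classOf)) (count-classOf X₂)
    where
    only-X₂ : ∀ Q → P₄ Y₂ Q ≡ (Q ≡ᶠ X₂)
    only-X₂ X₁ = refl
    only-X₂ X₂ = refl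
    only-X₂ Y₁ = refl
    only-X₂ Y₂ = refl

  not-one : ∀ {a b} → 1 ≤ a → 1 ≤ b → a + b ≢ 1
  not-one 1≤a 1≤b = <⇒≢ (+-mono-≤ 1≤a 1≤b) ∘ sym

  pendent-in-X : ∀ {u} → u ∈ X → Pendent G u → Position u X₁ × z Y₁ ≡ 1
  pendent-in-X {u} u∈X pend with classOf u | position u
  ... | _ | p@(at-X₁ _ _) = p , trans (sym (deg-X₁ p)) pend
  ... | _ | p@(at-X₂ _ _) = ⊥-elim (not-one (occupied Y₁) (occupied Y₂) (trans (sym (deg-X₂ p)) pend))
  ... | _ | at-Y₁ u∉X _ = ⊥-elim (u∉X u∈X)
  ... | _ | at-Y₂ u∉X _ = ⊥-elim (u∉X u∈X)

  pendent-in-Y : ∀ {u} → u ∈ ∁ X → Pendent G u → Position u Y₂ × z X₂ ≡ 1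
  pendent-in-Y {u} u∈Y pend with classOf u | position u
  ... | _ | at-X₁ u∈X _ = ⊥-elim (x∈∁p⇒x∉p u∈Y u∈X)
  ... | _ | at-X₂ u∈X _ = ⊥-elim (x∈∁p⇒x∉p u∈Y u∈X)
  ... | _ | p@(at-Y₁ _ _) = ⊥-elim (not-one (occupied X₁) (occupied X₂) (trans (sym (deg-Y₁ p)) pend))
  ... | _ | p@(at-Y₂ _ _) = p , trans (sym (deg-Y₂ p)) pend

  many-pendents-in-X : MoreThanOnePendent G X → z Y₁ ≤ 1 × 2 ≤ z X₁
  many-pendents-in-X (u , v , u≢v , u∈X , v∈X , pendᵤ , pendᵥ)
    with pendent-in-X u∈X pendᵤ | pendent-in-X v∈X pendᵥ
  ... | pu , zY₁≡1 | pv , _ = ≤-reflexive zY₁≡1 , two-members pu pv u≢v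

  many-pendents-in-Y : MoreThanOnePendent G (∁ X) → z X₂ ≤ 1 × 2 ≤ z Y₂
  many-pendents-in-Y (u , v , u≢v , u∈Y , v∈Y , pendᵤ , pendᵥ)
    with pendent-in-Y u∈Y pendᵤ | pendent-in-Y v∈Y pendᵥ
  ... | pu , zX₂≡1 | pv , _ = ≤-reflexive zX₂≡1 , two-members pu pv u≢v

  few-pendents-in-X : AtMostOnePendent G X → 2 ≤ z Y₁ ⊎ z X₁ ≤ 1
  few-pendents-in-X atMostOne = decide (z X₁ ≤? 1)
    where
    distinct : ∃[ u ] ∃[ v ] (u ≢ v × Position u X₁ × Position v X₁) → z Y₁ ≢ 1
    distinct (u , v , u≢v , pu@(at-X₁ u∈X _) , pv@(at-X₁ v∈X _)) zY₁≡1 =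
      u≢v (atMostOne u v u∈X v∈X (trans (deg-X₁ pu) zY₁≡1) (trans (deg-X₁ pv) zY₁≡1))
    decide : Dec (z X₁ ≤ 1) → 2 ≤ z Y₁ ⊎ z X₁ ≤ 1
    decide (yes zX₁≤1) = inj₂ zX₁≤1
    decide (no zX₁≰1) = inj₁ (≤∧≢⇒< (occupied Y₁) (≢-sym (distinct (two-members⁻ (≰⇒> zX₁≰1)))))

  few-pendents-in-Y : AtMostOnePendent G (∁ X) → 2 ≤ z X₂ ⊎ z Y₂ ≤ 1
  few-pendents-in-Y atMostOne = decide (z Y₂ ≤? 1)
    where
    distinct : ∃[ u ] ∃[ v ] (u ≢ v × Position u Y₂ × Position v Y₂) → z X₂ ≢ 1
    distinct (u , v , u≢v , pu@(at-Y₂ u∉X _) , pv@(at-Y₂ v∉X _)) zX₂≡1 =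
      u≢v (atMostOne u v (x∉p⇒x∈∁p u∉X) (x∉p⇒x∈∁p v∉X) (trans (deg-Y₂ pu) zX₂≡1) (trans (deg-Y₂ pv) zX₂≡1))
    decide : Dec (z Y₂ ≤ 1) → 2 ≤ z X₂ ⊎ z Y₂ ≤ 1
    decide (yes zY₂≤1) = inj₂ zY₂≤1
    decide (no zY₂≰1) = inj₁ (≤∧≢⇒< (occupied X₂) (≢-sym (distinct (two-members⁻ (≰⇒> zY₂≰1)))))

  no-pendents : (∀ v → ¬ Pendent G v) → 2 ≤ z Y₁ × 2 ≤ z X₂
  no-pendents none with y₂-witness
  ... | y , py = ≤∧≢⇒< (occupied Y₁) (≢-sym (none x₁ ∘ trans (deg-X₁ (at-X₁ x₁∈X refl)))) ,
                 ≤∧≢⇒< (occupied X₂) (≢-sym (none y ∘ trans (deg-Y₂ py)))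

  classSize-restrict : ∀ Z (keep : Fin 4 → Bool) → (∀ i → lookup Z i ≡ keep (classOf i)) →
    ∀ P → Restricted.classSize Z P ≡ (if keep P then z P else 0)
  classSize-restrict Z keep Z-spec P = trans (count-cong pointwise) (by-keep (keep P))
    where
    select : ∀ Q → (keep Q ∧ (Q ≡ᶠ P)) ≡ (if keep P then Q ≡ᶠ P else false)
    select Q with Q ≟ P | keep P in keepP
    ... | yes refl | true rewrite keepP = refl
    ... | yes refl | false rewrite keepP = refl
    ... | no _ | true = ∧-zeroʳ (keep Q)
    ... | no _ | false = ∧-zeroʳ (keep Q)
    pointwise : ∀ i → (lookup Z i ∧ (classOf i ≡ᶠ P)) ≡ (if keep P then classOf i ≡ᶠ P else false)
    pointwise i rewrite Z-spec i = select (classOf i)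
    by-keep : ∀ b → count (λ i → if b then classOf i ≡ᶠ P else false) ≡ (if b then z P else 0)
    by-keep true = count-classOf P
    by-keep false = count-false n

  first-half : ∀ i → lookup (V₁ G X x₁ x₂) i ≡ (classOf i ≡ᶠ X₁) ∨ (classOf i ≡ᶠ Y₁)
  first-half i rewrite lookup-zipWith _∨_ i (XClass G X x₁) (N G x₁)
                     | lookup∘tabulate (λ v → lookup X v ∧ sameNeighbourhood v x₁) i
                     | lookup∘tabulate (adj G x₁) i
                     with classOf i | position i
  ... | _ | at-X₁ i∈X Nᵢ rewrite []=⇒lookup i∈X | dec-true (≡-dec Bool._≟_ (N G i) (N G x₁)) Nᵢ = refl
  ... | _ | at-X₂ i∈X Nᵢ rewrite []=⇒lookup i∈X
                               | dec-false (≡-dec Bool._≟_ (N G i) (N G x₁)) (N₂≢N₁ ∘ trans (sym Nᵢ))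
                               | no-edge-in-X x₁∈X i∈X = refl
  ... | _ | at-Y₁ i∉X e rewrite ∉⇒lookup i∉X | e = refl
  ... | _ | at-Y₂ i∉X e rewrite ∉⇒lookup i∉X | e = refl

  second-half : ∀ i → lookup (V₂ G X x₁ x₂) i ≡ (classOf i ≡ᶠ X₂) ∨ (classOf i ≡ᶠ Y₂)
  second-half i rewrite lookup-zipWith _∨_ i (XClass G X x₂) (N G x₂ ─ N G x₁)
                      | lookup∘tabulate (λ v → lookup X v ∧ sameNeighbourhood v x₂) i
                      | lookup-─ (N G x₂) (N G x₁) i
                      | lookup∘tabulate (adj G x₂) i
                      | lookup∘tabulate (adj G x₁) i
                      with classOf i | position i
  ... | _ | at-X₁ i∈X Nᵢ rewrite []=⇒lookup i∈X
                               | dec-false (≡-dec Bool._≟_ (N G i) (N G x₂))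
                                           (λ Nᵢ≡N₂ → N₂≢N₁ (trans (sym Nᵢ≡N₂) Nᵢ))
                               | no-edge-in-X x₂∈X i∈X = refl
  ... | _ | at-X₂ i∈X Nᵢ rewrite []=⇒lookup i∈X | dec-true (≡-dec Bool._≟_ (N G i) (N G x₂)) Nᵢ = refl
  ... | _ | at-Y₁ i∉X e rewrite ∉⇒lookup i∉X | e | x₂-sees-Y i∉X = refl
  ... | _ | at-Y₂ i∉X e rewrite ∉⇒lookup i∉X | e | x₂-sees-Y i∉X = refl

  first-half-size : ∀ P → Restricted.classSize (V₁ G X x₁ x₂) P ≡ profile (z X₁) 0 (z Y₁) 0 P
  first-half-size P = trans (classSize-restrict (V₁ G X x₁ x₂) _ first-half P) (by-class P)
    where
    by-class : ∀ P → (if (P ≡ᶠ X₁) ∨ (P ≡ᶠ Y₁) then z P else 0) ≡ profile (z X₁) 0 (z Y₁) 0 P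
    by-class X₁ = refl
    by-class X₂ = refl
    by-class Y₁ = refl
    by-class Y₂ = refl

  second-half-size : ∀ P → Restricted.classSize (V₂ G X x₁ x₂) P ≡ profile 0 (z X₂) 0 (z Y₂) P
  second-half-size P = trans (classSize-restrict (V₂ G X x₁ x₂) _ second-half P) (by-class P)
    where
    by-class : ∀ P → (if (P ≡ᶠ X₂) ∨ (P ≡ᶠ Y₂) then z P else 0) ≡ profile 0 (z X₂) 0 (z Y₂) P
    by-class X₁ = refl
    by-class X₂ = refl
    by-class Y₁ = refl
    by-class Y₂ = refl

  few-pendents-γ : 2 ≤ z Y₁ ⊎ z X₁ ≤ 1 → 2 ≤ z X₂ ⊎ z Y₂ ≤ 1 → GammaCS G (min4 ∣ X ∣ ∣ ∁ X ∣)
  few-pendents-γ left right = subst (GammaCS G) (cong₂ min4 (sym ∣X∣≡) (sym ∣Y∣≡))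
    (GammaCSIn-fromProfile (FewPendents-γ z (FewPendentsᵇ-intro occupied left right)))

  without-pendents : (∀ v → ¬ Pendent G v) →
    ((∣ X ∣ ≡ 3 ⊎ ∣ ∁ X ∣ ≡ 3) → GammaCS G 3) × (∣ X ∣ ≢ 3 → ∣ ∁ X ∣ ≢ 3 → GammaCS G 4)
  without-pendents none with no-pendents none
  ... | 2≤zY₁ , 2≤zX₂ = (λ three → at (proj₁ value three)) , (λ ∣X∣≢3 ∣Y∣≢3 → at (proj₂ value ∣X∣≢3 ∣Y∣≢3))
    where
    at : ∀ {k} → min4 ∣ X ∣ ∣ ∁ X ∣ ≡ k → GammaCS G k
    at k≡ = subst (GammaCS G) k≡ (few-pendents-γ (inj₁ 2≤zY₁) (inj₁ 2≤zX₂))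
    value : ((∣ X ∣ ≡ 3 ⊎ ∣ ∁ X ∣ ≡ 3) → min4 ∣ X ∣ ∣ ∁ X ∣ ≡ 3) ×
            (∣ X ∣ ≢ 3 → ∣ ∁ X ∣ ≢ 3 → min4 ∣ X ∣ ∣ ∁ X ∣ ≡ 4)
    value = min4-3-or-4 (subst (3 ≤_) (sym ∣X∣≡) (+-mono-≤ (occupied X₁) 2≤zX₂))
                        (subst (3 ≤_) (sym ∣Y∣≡) (+-mono-≤ 2≤zY₁ (occupied Y₂)))

  with-few-pendents : AtMostOnePendent G X → AtMostOnePendent G (∁ X) →
    ((∣ X ∣ ≡ 2 ⊎ ∣ ∁ X ∣ ≡ 2) → GammaCS G 2) ×
    (∣ X ∣ ≢ 2 → ∣ ∁ X ∣ ≢ 2 → (∣ X ∣ ≡ 3 ⊎ ∣ ∁ X ∣ ≡ 3) → GammaCS G 3) ×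
    (∣ X ∣ ≢ 2 → ∣ ∁ X ∣ ≢ 2 → ∣ X ∣ ≢ 3 → ∣ ∁ X ∣ ≢ 3 → GammaCS G 4)
  with-few-pendents fewX fewY =
    (λ two → at (proj₁ value two)) ,
    (λ ∣X∣≢2 ∣Y∣≢2 three → at (proj₁ (proj₂ value ∣X∣≢2 ∣Y∣≢2) three)) ,
    (λ ∣X∣≢2 ∣Y∣≢2 ∣X∣≢3 ∣Y∣≢3 → at (proj₂ (proj₂ value ∣X∣≢2 ∣Y∣≢2) ∣X∣≢3 ∣Y∣≢3))
    where
    at : ∀ {k} → min4 ∣ X ∣ ∣ ∁ X ∣ ≡ k → GammaCS G k
    at k≡ = subst (GammaCS G) k≡ (few-pendents-γ (few-pendents-in-X fewX) (few-pendents-in-Y fewY))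
    value : ((∣ X ∣ ≡ 2 ⊎ ∣ ∁ X ∣ ≡ 2) → min4 ∣ X ∣ ∣ ∁ X ∣ ≡ 2) ×
            (∣ X ∣ ≢ 2 → ∣ ∁ X ∣ ≢ 2 → ((∣ X ∣ ≡ 3 ⊎ ∣ ∁ X ∣ ≡ 3) → min4 ∣ X ∣ ∣ ∁ X ∣ ≡ 3) ×
                                     (∣ X ∣ ≢ 3 → ∣ ∁ X ∣ ≢ 3 → min4 ∣ X ∣ ∣ ∁ X ∣ ≡ 4))
    value = min4-2-3-or-4 (subst (2 ≤_) (sym ∣X∣≡) (+-mono-≤ (occupied X₁) (occupied X₂)))
                          (subst (2 ≤_) (sym ∣Y∣≡) (+-mono-≤ (occupied Y₁) (occupied Y₂)))

  with-many-pendents : MoreThanOnePendent G X ⊎ MoreThanOnePendent G (∁ X) →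
    ∃[ a ] ∃[ b ] (GammaCSIn G (V₁ G X x₁ x₂) a × GammaCSIn G (V₂ G X x₁ x₂) b × GammaCS G (a + b))
  with-many-pendents many = γK (z X₁) (z Y₁) , γK (z X₂) (z Y₂) , first , second , whole
    where
    whole : GammaCS G (γ-split z)
    whole = GammaCSIn-fromProfile (Decomposable-γ z
      (Decomposableᵇ-intro occupied (⊎-map many-pendents-in-X many-pendents-in-Y many)))
    first : GammaCSIn G (V₁ G X x₁ x₂) (γK (z X₁) (z Y₁))
    first = subst (GammaCSIn G (V₁ G X x₁ x₂)) (trans (γ-split-≗ first-half-size) (+-identityʳ _))
      (Restricted.GammaCSIn-fromProfile (V₁ G X x₁ x₂) (Decomposable-γ _
        (subst T (Decomposableᵇ-≈ (inj₁ ∘ sym ∘ first-half-size))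
                 (Decomposableᵇ-first (occupied X₁) (occupied Y₁)))))
    second : GammaCSIn G (V₂ G X x₁ x₂) (γK (z X₂) (z Y₂))
    second = subst (GammaCSIn G (V₂ G X x₁ x₂)) (γ-split-≗ second-half-size)
      (Restricted.GammaCSIn-fromProfile (V₂ G X x₁ x₂) (Decomposable-γ _
        (subst T (Decomposableᵇ-≈ (inj₁ ∘ sym ∘ second-half-size))
                 (Decomposableᵇ-second (occupied X₂) (occupied Y₂)))))

mainTheorem15 : ∀ {n : ℕ} (G : Graph n) (X : Subset n) (x₁ x₂ : Fin n) →
    NoIsolated G → Connected G → ChainGraph G X → TwoClasses G X x₁ x₂ →
    ((∀ v → ¬ Pendent G v) →
       ((∣ X ∣ ≡ 3 ⊎ ∣ ∁ X ∣ ≡ 3) → GammaCS G 3) ×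
       (∣ X ∣ ≢ 3 → ∣ ∁ X ∣ ≢ 3 → GammaCS G 4))
    ×
    ((MoreThanOnePendent G X ⊎ MoreThanOnePendent G (∁ X)) →
       ∃[ a ] ∃[ b ] (GammaCSIn G (V₁ G X x₁ x₂) a × GammaCSIn G (V₂ G X x₁ x₂) b ×
                      GammaCS G (a + b)))
    ×
    (AtMostOnePendent G X → AtMostOnePendent G (∁ X) →
       ((∣ X ∣ ≡ 2 ⊎ ∣ ∁ X ∣ ≡ 2) → GammaCS G 2) ×
       (∣ X ∣ ≢ 2 → ∣ ∁ X ∣ ≢ 2 → (∣ X ∣ ≡ 3 ⊎ ∣ ∁ X ∣ ≡ 3) → GammaCS G 3) ×
       (∣ X ∣ ≢ 2 → ∣ ∁ X ∣ ≢ 2 → ∣ X ∣ ≢ 3 → ∣ ∁ X ∣ ≢ 3 → GammaCS G 4))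
mainTheorem15 G X x₁ x₂ noIsolated _ chain classes = without-pendents , with-many-pendents , with-few-pendents
  where open TwoClassChainGraph G X x₁ x₂ noIsolated chain classes
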